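{- Let $\widetilde G=(I,P;E)$ be a pinned $d$-isostatic graph. The following are equivalent: (1) $\widetilde G$ contains no proper pinned $d$-isostatic subgraph, i.e. there is no pinned $d$-isostatic subgraph $(I',P';E')$ with $\emptyset\ne I'\subsetneq I$; (2) for some (equivalently, any) $d$-directed orientation of $\widetilde G$, after contracting all pinned vertices to a single ground vertex, all inner vertices lie in a single strongly connected component (the graph is indecomposable); (3) for a generic configuration $p$, the pinned rigidity matrix $R(\widetilde G,p)$ has no proper lower block-triangular decomposition (i.e. none with more than one diagonal block).
   Context: Fix $d\ge1$. A pinned graph $\widetilde G=(I,P;E)$ has disjoint finite sets $I$ (inner vertices) and $P$ (pinned vertices) and a finite multiset $E$ of edges, each an unordered pair of distinct vertices with at least one endpoint in $I$. A subgraph is $(I',P';E')$ with $I'\subseteq I$, $P'\subseteq P$, $E'\subseteq E$ consisting of edges with endpoints in $I'\cup P'$ (and at least one endpoint in $I'$). A configuration $p$ assigns $p_v\in\mathbb R^d$ to each vertex. The pinned rigidity matrix $R(\widetilde G,p)$ is the $|E|\times d|I|$ matrix with one row per edge and $d$ columns per inner vertex: the row of $\{i,j\}$, $i,j\in I$, has $p_i-p_j$ in the columns of $i$, $p_j-p_i$ in the columns of $j$, zeros elsewhere; the row of $\{i,k\}$, $i\in I$, $k\in P$, has $p_i-p_k$ in the columns of $i$, zeros elsewhere. A configuration is generic if it lies in the open dense set where $R(\widetilde G,p)$ attains its maximum rank. A pinned graph is pinned $d$-isostatic if for some (equivalently every generic) $p$ its pinned rigidity matrix is square and invertible. A $d$-directed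 orientation orients each edge so every inner vertex has out-degree $d$ and every pinned vertex out-degree $0$. A lower block-triangular decomposition of $R(\widetilde G,p)$ is obtained by permuting rows and permuting inner vertices (keeping each vertex's $d$ columns together) so that the matrix is lower block-triangular with square diagonal blocks. A pinned $d$-isostatic graph satisfying these equivalent conditions is called $d$-Assur.
   Formalization: Configurations take values in ℚ^d rather than ℝ^d, wherever they occur: in pinned $d$-isostaticity of the graph and its subgraphs, in genericity, and in condition (3). -}

module Defs where

open import Data.Nat using (ℕ; zero; suc; _≤_)
import Data.Nat as ℕ
open import Data.Fin using (Fin; zero; suc)
import Data.Fin as Fin
open import Data.Bool using (Bool; true; false; if_then_else_; _∧_)
open import Data.Sum using (_⊎_; inj₁; inj₂)
open import Data.Product using (Σ; ∃; ∃-syntax; _×_; _,_)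
open import Data.Unit using (⊤; tt)
open import Data.Rational using (ℚ; 0ℚ; 1ℚ; _+_; _*_; _-_)
open import Relation.Nullary using (¬_; does)
open import Relation.Binary.PropositionalEquality using (_≡_; _≢_)
open import Relation.Binary.Construct.Closure.ReflexiveTransitive using (Star)
open import Function.Definitions using (Injective)

-- The edge multiset is indexed by Fin m.  Since every edge has at least one
-- inner endpoint, edge e is stored as the pair {inner e , other e} with
-- inner e an inner vertex and other e an arbitrary vertex distinct from it.
-- (For an inner–inner edge the choice which endpoint is "inner e" is an
-- arbitrary representation choice; the edge is unordered.)

Vtx : ℕ → ℕ → Set
Vtx nI nP = Fin nI ⊎ Fin nP

record PinnedGraph : Set where
  field
    nI nP m  : ℕ
    inner    : Fin m → Fin nI
    other    : Fin m → Vtx nI nP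
    distinct : ∀ e j → other e ≡ inj₁ j → inner e ≢ j

open PinnedGraph public

_==V_ : ∀ {nI nP} → Vtx nI nP → Vtx nI nP → Bool
inj₁ i ==V inj₁ j = does (i Fin.≟ j)
inj₂ k ==V inj₂ l = does (k Fin.≟ l)
_ ==V _ = false

_==F_ : ∀ {n} → Fin n → Fin n → Bool
i ==F j = does (i Fin.≟ j)

sumFin : (n : ℕ) → (Fin n → ℚ) → ℚ
sumFin zero    f = 0ℚ
sumFin (suc n) f = f zero + sumFin n (λ i → f (suc i))

sumOn : (n : ℕ) → (Fin n → Bool) → (Fin n → ℚ) → ℚ
sumOn n S f = sumFin n (λ i → if S i then f i else 0ℚ)

count : (n : ℕ) → (Fin n → Bool) → ℕ
count zero    S = zero
count (suc n) S = (if S zero then 1 else 0) ℕ.+ count n (λ i → S (suc i))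

δ : Bool → ℚ
δ true  = 1ℚ
δ false = 0ℚ

Config : ℕ → PinnedGraph → Set
Config d G = Vtx (nI G) (nP G) → Fin d → ℚ

Col : ℕ → PinnedGraph → Set
Col d G = Fin (nI G) × Fin d

-- Entry of R(G,p) in row e and column (i , a).
-- Row of edge {u,w}: p_u - p_w in the columns of u (if u inner),
-- p_w - p_u in the columns of w (if w inner), zero elsewhere.
rigidity : (d : ℕ) (G : PinnedGraph) → Config d G → Fin (m G) → Col d G → ℚ
rigidity d G p e (i , a) =
  (if inner G e ==F i then p u a - p w a else 0ℚ) +
  (if w ==V inj₁ i then p w a - p u a else 0ℚ)
  where
    u = inj₁ (inner G e)
    w = other G e

-- The restriction of R(G,p) to rows E' and inner vertices I' (all d columns
-- of each) is square and invertible (two-sided inverse B).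
SquareInvertibleOn : (d : ℕ) (G : PinnedGraph) → Config d G →
                     (Fin (nI G) → Bool) → (Fin (m G) → Bool) → Set
SquareInvertibleOn d G p I' E' =
  (count (m G) E' ≡ d ℕ.* count (nI G) I') ×
  Σ (Col d G → Fin (m G) → ℚ) λ B →
    (∀ e e' → E' e ≡ true → E' e' ≡ true →
       sumOn (nI G) I' (λ i → sumFin d (λ a →
          rigidity d G p e (i , a) * B (i , a) e')) ≡ δ (e ==F e')) ×
    (∀ i a j b → I' i ≡ true → I' j ≡ true →
       sumOn (m G) E' (λ e → B (i , a) e * rigidity d G p e (j , b))
         ≡ δ ((i ==F j) ∧ (a ==F b)))

PinnedIsostatic : ℕ → PinnedGraph → Set
PinnedIsostatic d G =
  ∃[ p ] SquareInvertibleOn d G p (λ _ → true) (λ _ → true)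

record Subgraph (G : PinnedGraph) : Set where
  field
    I' : Fin (nI G) → Bool
    P' : Fin (nP G) → Bool
    E' : Fin (m G) → Bool
    innerIn : ∀ e → E' e ≡ true → I' (inner G e) ≡ true
    otherInnerIn : ∀ e j → E' e ≡ true → other G e ≡ inj₁ j → I' j ≡ true
    otherPinnedIn : ∀ e k → E' e ≡ true → other G e ≡ inj₂ k → P' k ≡ true

open Subgraph public

-- The subgraph (I',P';E'), as a pinned graph, is pinned d-isostatic.
-- (Its pinned rigidity matrix is the restriction of R(G,p) to rows E' and
--  the columns of the inner vertices I'.)
SubgraphIsostatic : (d : ℕ) (G : PinnedGraph) → Subgraph G → Set
SubgraphIsostatic d G H = ∃[ p ] SquareInvertibleOn d G p (I' H) (E' H)

ProperSub : (G : PinnedGraph) → Subgraph G → Set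
ProperSub G H = (∃[ i ] I' H i ≡ true) × (∃[ j ] I' H j ≡ false)

NoProperIsostaticSubgraph : ℕ → PinnedGraph → Set
NoProperIsostaticSubgraph d G =
  ¬ (Σ (Subgraph G) λ H → ProperSub G H × SubgraphIsostatic d G H)

-- orient e = true  : edge e is directed  inner e → other e
-- orient e = false : edge e is directed  other e → inner e

Orientation : PinnedGraph → Set
Orientation G = Fin (m G) → Bool

tail : (G : PinnedGraph) → Orientation G → Fin (m G) → Vtx (nI G) (nP G)
tail G o e = if o e then inj₁ (inner G e) else other G e

head : (G : PinnedGraph) → Orientation G → Fin (m G) → Vtx (nI G) (nP G)
head G o e = if o e then other G e else inj₁ (inner G e)

DDirected : ℕ → (G : PinnedGraph) → Orientation G → Set
DDirected d G o =
  (∀ u → count (m G) (λ e → tail G o e ==V inj₁ u) ≡ d) ×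
  (∀ k → count (m G) (λ e → tail G o e ==V inj₂ k) ≡ 0)

contract : ∀ {nI nP} → Vtx nI nP → Fin nI ⊎ ⊤
contract (inj₁ i) = inj₁ i
contract (inj₂ _) = inj₂ tt

Arc : (G : PinnedGraph) → Orientation G → Fin (nI G) ⊎ ⊤ → Fin (nI G) ⊎ ⊤ → Set
Arc G o x y = ∃[ e ] (contract (tail G o e) ≡ x × contract (head G o e) ≡ y)

Reach : (G : PinnedGraph) → Orientation G → Fin (nI G) ⊎ ⊤ → Fin (nI G) ⊎ ⊤ → Set
Reach G o = Star (Arc G o)

Indecomposable : (G : PinnedGraph) → Orientation G → Set
Indecomposable G o = ∀ u w → Reach G o (inj₁ u) (inj₁ w)

-- rank of R(G,p) is at least k: some k×k submatrix is invertible
RankAtLeast : (d : ℕ) (G : PinnedGraph) → Config d G → ℕ → Set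
RankAtLeast d G p k =
  Σ (Fin k → Fin (m G)) λ r → Σ (Fin k → Col d G) λ c →
  Injective _≡_ _≡_ r × Injective _≡_ _≡_ c ×
  Σ (Fin k → Fin k → ℚ) λ B →
    (∀ s t → sumFin k (λ x → rigidity d G p (r s) (c x) * B x t) ≡ δ (s ==F t)) ×
    (∀ s t → sumFin k (λ x → B s x * rigidity d G p (r x) (c t)) ≡ δ (s ==F t))

-- generic: R(G,p) attains the maximum rank over all configurations
Generic : (d : ℕ) (G : PinnedGraph) → Config d G → Set
Generic d G p = ∀ q k → RankAtLeast d G q k → RankAtLeast d G p k

-- A lower block-triangular decomposition with k diagonal blocks:
-- after permuting rows and inner vertices, rows in block ρ e and the
-- columns of inner vertex i in block σ i; blocks are ordered 0 < 1 < … < k-1,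
-- diagonal blocks are square and nonempty, and every entry above the
-- diagonal blocks vanishes.
record LowerBlockTriangular (d : ℕ) (G : PinnedGraph) (p : Config d G) : Set where
  field
    blocks   : ℕ
    rowBlock : Fin (m G) → Fin blocks
    vtxBlock : Fin (nI G) → Fin blocks
    square   : ∀ b → count (m G) (λ e → rowBlock e ==F b)
                       ≡ d ℕ.* count (nI G) (λ i → vtxBlock i ==F b)
    nonempty : ∀ b → ∃[ i ] vtxBlock i ≡ b
    lower    : ∀ e i a → rigidity d G p e (i , a) ≢ 0ℚ →
                 Fin.toℕ (vtxBlock i) ≤ Fin.toℕ (rowBlock e)

open LowerBlockTriangular public

HasProperLBT : (d : ℕ) (G : PinnedGraph) → Config d G → Set
HasProperLBT d G p = Σ (LowerBlockTriangular d G p) λ D → 2 ≤ blocks D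

-- Everything turns on tight subgraphs, those with |E'| = d |I'|.  A tight subgraph is pinned
-- d-isostatic: its rows of R(G,p) vanish outside the columns of I', so they stay independent and
-- form a square nonsingular minor.  A proper tight subgraph gives a set of inner vertices closed
-- under every d-directed orientation (the d |I'| edges leaving I' must be exactly E') and the first
-- block of a two-block lower triangular decomposition.  Conversely, the inner vertices reachable
-- from one vertex in a d-directed orientation span a tight subgraph, and so does the first diagonal
-- block of a decomposition at a generic configuration, where every edge row is nonzero at all its
-- inner endpoints.  d-directed orientations exist because the invertible matrix R(G,p) has a
-- transversal, matching each edge with a column, i.e. with one of its endpoints and a coordinate.

module Submission where

open import Defs
open import Data.Nat as ℕ using (ℕ; zero; suc; _≤_; _<_; z≤n; s≤s)
import Data.Nat.Properties as ℕP
open import Data.Fin as Fin using (Fin; zero; suc; toℕ; combine; remQuot)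
import Data.Fin.Properties as FinP
open import Data.Bool as Bool using (Bool; true; false; if_then_else_; _∧_; _∨_; not)
import Data.Bool.Properties as BoolP
open import Data.Sum using (_⊎_; inj₁; inj₂)
open import Data.Sum.Properties using (inj₁-injective; ≡-dec)
open import Data.Product using (Σ; ∃; ∃-syntax; _×_; _,_; proj₁; proj₂; uncurry)
open import Data.Unit using (⊤)
open import Data.Empty using (⊥; ⊥-elim)
open import Data.Rational using (ℚ; 0ℚ; 1ℚ; _+_; _*_; _-_; -_; 1/_; ≢-nonZero)
import Data.Rational.Properties as ℚP
open import Data.Rational.Solver using (module +-*-Solver)
open import Relation.Nullary using (¬_; Dec; does; yes; no)
open import Relation.Nullary.Decidable using (dec-true; dec-false; _×-dec_; ¬?; decidable-stable)
open import Relation.Binary.PropositionalEquality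
open import Relation.Binary.Construct.Closure.ReflexiveTransitive using (Star; ε; _◅_; _◅◅_; fold; gmap)
open import Function using (_∘_; id)
open import Function.Bundles using (_⇔_; mk⇔)
open import Function.Definitions using (Injective)

open +-*-Solver

-- Subsets of Fin n and counting

Subset : ℕ → Set
Subset n = Fin n → Bool

infix 4 _∈_ _∉_ _⊆_
infixl 6 _─_

_∈_ : ∀ {n} → Fin n → Subset n → Set
i ∈ S = S i ≡ true

_∉_ : ∀ {n} → Fin n → Subset n → Set
i ∉ S = S i ≡ false

_⊆_ : ∀ {n} → Subset n → Subset n → Set
S ⊆ T = ∀ i → i ∈ S → i ∈ T

∈∉⇒⊥ : ∀ {n} {S : Subset n} {i} → i ∈ S → i ∉ S → ⊥
∈∉⇒⊥ i∈S i∉S with () ← trans (sym i∈S) i∉S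

==F-refl : ∀ {n} (i : Fin n) → (i ==F i) ≡ true
==F-refl i = dec-true (i Fin.≟ i) refl

==F-false : ∀ {n} {i j : Fin n} → i ≢ j → (i ==F j) ≡ false
==F-false {i = i} {j} = dec-false (i Fin.≟ j)

==F⇒≡ : ∀ {n} {i j : Fin n} → (i ==F j) ≡ true → i ≡ j
==F⇒≡ {i = i} {j} h with i Fin.≟ j
... | yes i≡j = i≡j

==F-injective : ∀ {n k} {f : Fin n → Fin k} → Injective _≡_ _≡_ f →
                ∀ i j → (f i ==F f j) ≡ (i ==F j)
==F-injective {f = f} f-inj i j with i Fin.≟ j
... | yes refl = ==F-refl (f i)
... | no i≢j = ==F-false (λ fi≡fj → i≢j (f-inj fi≡fj))

==F-sym : ∀ {n} (i j : Fin n) → (i ==F j) ≡ (j ==F i)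
==F-sym i j with i Fin.≟ j
... | yes refl = sym (==F-refl i)
... | no i≢j   = sym (==F-false (i≢j ∘ sym))

any-true? : ∀ {n} (S : Subset n) → (∃[ i ] i ∈ S) ⊎ (∀ i → i ∉ S)
any-true? S with FinP.any? (λ i → S i Bool.≟ true)
... | yes found = inj₁ found
... | no none = inj₂ (λ i → BoolP.¬-not (λ i∈S → none (i , i∈S)))

_─_ : ∀ {n} → Subset n → Fin n → Subset n
(S ─ j) i = S i ∧ not (i ==F j)

∈-─⁻ : ∀ {n} {S : Subset n} {j i} → i ∈ S ─ j → i ∈ S × i ≢ j
∈-─⁻ {S = S} {j} {i} h with S i | i Fin.≟ j
∈-─⁻ () | false | _
∈-─⁻ () | true  | yes _
... | true | no i≢j = refl , i≢j

∈-─⁺ : ∀ {n} {S : Subset n} {j i} → i ∈ S → i ≢ j → i ∈ S ─ j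
∈-─⁺ {S = S} {j} {i} i∈S i≢j rewrite i∈S | ==F-false i≢j = refl

count-cong : ∀ n {S T : Subset n} → (∀ i → S i ≡ T i) → count n S ≡ count n T
count-cong zero    S≗T = refl
count-cong (suc n) S≗T =
  cong₂ (λ b c → (if b then 1 else 0) ℕ.+ c) (S≗T zero) (count-cong n (S≗T ∘ suc))

count-empty : ∀ n {S : Subset n} → (∀ i → i ∉ S) → count n S ≡ 0
count-empty zero    none = refl
count-empty (suc n) none rewrite none zero = count-empty n (none ∘ suc)

count-full : ∀ n → count n (λ _ → true) ≡ n
count-full zero    = refl
count-full (suc n) = cong suc (count-full n)

count-≤ : ∀ n (S : Subset n) → count n S ≤ n
count-≤ zero    S = z≤n
count-≤ (suc n) S with S zero
... | true  = s≤s (count-≤ n (S ∘ suc))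
... | false = ℕP.m≤n⇒m≤1+n (count-≤ n (S ∘ suc))

count-─ : ∀ n {S : Subset n} {j} → j ∈ S → count n S ≡ suc (count n (S ─ j))
count-─ (suc n) {S} {zero} j∈S rewrite j∈S =
  cong suc (count-cong n (λ i → sym (BoolP.∧-identityʳ (S (suc i)))))
count-─ (suc n) {S} {suc j} j∈S
  rewrite count-─ n {S ∘ suc} j∈S | BoolP.∧-identityʳ (S zero) = ℕP.+-suc _ _

count≡0⇒∉ : ∀ n {S : Subset n} → count n S ≡ 0 → ∀ i → i ∉ S
count≡0⇒∉ n {S} c≡0 i with S i in i∈S
... | true  with () ← trans (sym (count-─ n i∈S)) c≡0
... | false = refl

count>0⇒nonempty : ∀ n {S : Subset n} → 0 < count n S → ∃[ i ] i ∈ S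
count>0⇒nonempty n {S} 0<count with any-true? S
... | inj₁ found = found
... | inj₂ none with () ← subst (0 <_) (count-empty n none) 0<count

count-mono : ∀ n {S T : Subset n} → S ⊆ T → count n S ≤ count n T
count-mono zero    S⊆T = z≤n
count-mono (suc n) {S} {T} S⊆T with S zero in eS | T zero in eT
... | true  | true  = s≤s (count-mono n (S⊆T ∘ suc))
... | true  | false with () ← trans (sym (S⊆T zero eS)) eT
... | false | true  = ℕP.m≤n⇒m≤1+n (count-mono n (S⊆T ∘ suc))
... | false | false = count-mono n (S⊆T ∘ suc)

count-<  : ∀ n {S T : Subset n} → S ⊆ T → ∀ {j} → j ∈ T → j ∉ S → count n S < count n T
count-< n {S} {T} S⊆T {j} j∈T j∉S = subst (count n S <_) (sym (count-─ n j∈T))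
  (s≤s (count-mono n (λ i i∈S → ∈-─⁺ {S = T} (S⊆T i i∈S) (λ { refl → ∈∉⇒⊥ {S = S} i∈S j∉S }))))

⊆-count-≥⇒⊇ : ∀ n {S T : Subset n} → S ⊆ T → count n T ≤ count n S → T ⊆ S
⊆-count-≥⇒⊇ n {S} {T} S⊆T T≤S j j∈T with S j in eS
... | true  = refl
... | false = ⊥-elim (ℕP.<⇒≱ (count-< n S⊆T j∈T eS) T≤S)

count-compl : ∀ n (S : Subset n) → count n S ℕ.+ count n (not ∘ S) ≡ n
count-compl zero    S = refl
count-compl (suc n) S with S zero
... | true  = cong suc (count-compl n (S ∘ suc))
... | false = trans (ℕP.+-suc _ _) (cong suc (count-compl n (S ∘ suc)))

count-∘-─ : ∀ m {n} (t : Fin m → Fin n) {S : Subset n} {j} → j ∈ S →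
            count m (S ∘ t) ≡ count m (λ e → t e ==F j) ℕ.+ count m ((S ─ j) ∘ t)
count-∘-─ zero    t j∈S = refl
count-∘-─ (suc m) t {S} {j} j∈S with t zero Fin.≟ j
... | yes refl rewrite j∈S = cong suc (count-∘-─ m (t ∘ suc) {S} j∈S)
... | no t0≢j rewrite BoolP.∧-identityʳ (S (t zero)) = begin
  b ℕ.+ count m (S ∘ t ∘ suc)             ≡⟨ cong (b ℕ.+_) (count-∘-─ m (t ∘ suc) {S} j∈S) ⟩
  b ℕ.+ (F ℕ.+ R)                         ≡⟨ ℕP.+-comm b _ ⟩
  (F ℕ.+ R) ℕ.+ b                         ≡⟨ ℕP.+-assoc F R b ⟩
  F ℕ.+ (R ℕ.+ b)                         ≡⟨ cong (F ℕ.+_) (ℕP.+-comm R b) ⟩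
  F ℕ.+ (b ℕ.+ R)                         ∎
  where
  open ≡-Reasoning
  b = if S (t zero) then 1 else 0
  F = count m (λ e → t (suc e) ==F j)
  R = count m ((S ─ j) ∘ t ∘ suc)

module _ {m n} (t : Fin m → Fin n) (d : ℕ) where

  fibre : Fin n → ℕ
  fibre u = count m (λ e → t e ==F u)

  private
    remove-one : ∀ {k} {S : Subset n} → count n S ≡ suc k →
                 ∃[ j ] (count m (S ∘ t) ≡ fibre j ℕ.+ count m ((S ─ j) ∘ t) × count n (S ─ j) ≡ k)
    remove-one {k} {S} cS≡ with count>0⇒nonempty n (subst (0 <_) (sym cS≡) (s≤s z≤n))
    ... | j , j∈S = j , count-∘-─ m t j∈S , ℕP.suc-injective (trans (sym (count-─ n j∈S)) cS≡)

    none-hit : ∀ {S : Subset n} → count n S ≡ 0 → count m (S ∘ t) ≡ d ℕ.* 0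
    none-hit cS≡0 = trans (count-empty m (count≡0⇒∉ n cS≡0 ∘ t)) (sym (ℕP.*-zeroʳ d))

  count-preimage-≤ : (∀ u → fibre u ≤ d) → ∀ S → count m (S ∘ t) ≤ d ℕ.* count n S
  count-preimage-≤ fibre≤ S = go (count n S) refl
    where
    go : ∀ k {S} → count n S ≡ k → count m (S ∘ t) ≤ d ℕ.* k
    go zero    cS≡0 = ℕP.≤-reflexive (none-hit cS≡0)
    go (suc k) {S} cS≡ with remove-one cS≡
    ... | j , split , cS─j≡k = begin
      count m (S ∘ t)                     ≡⟨ split ⟩
      fibre j ℕ.+ count m ((S ─ j) ∘ t)   ≤⟨ ℕP.+-mono-≤ (fibre≤ j) (go k cS─j≡k) ⟩
      d ℕ.+ d ℕ.* k                       ≡⟨ ℕP.*-suc d k ⟨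
      d ℕ.* suc k                         ∎
      where open ℕP.≤-Reasoning

  count-preimage-≡ : (∀ u → fibre u ≡ d) → ∀ S → count m (S ∘ t) ≡ d ℕ.* count n S
  count-preimage-≡ fibre≡ S = go (count n S) refl
    where
    go : ∀ k {S} → count n S ≡ k → count m (S ∘ t) ≡ d ℕ.* k
    go zero    cS≡0 = none-hit cS≡0
    go (suc k) {S} cS≡ with remove-one cS≡
    ... | j , split , cS─j≡k = begin
      count m (S ∘ t)                     ≡⟨ split ⟩
      fibre j ℕ.+ count m ((S ─ j) ∘ t)   ≡⟨ cong₂ ℕ._+_ (fibre≡ j) (go k cS─j≡k) ⟩
      d ℕ.+ d ℕ.* k                       ≡⟨ ℕP.*-suc d k ⟨
      d ℕ.* suc k                         ∎
      where open ≡-Reasoning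

  fibres-full : (∀ u → fibre u ≤ d) → m ≡ n ℕ.* d → ∀ u → fibre u ≡ d
  fibres-full fibre≤ m≡nd u =
    ℕP.≤-antisym (fibre≤ u) (ℕP.+-cancelʳ-≤ (d ℕ.* k) d (fibre u) bound)
    where
    k = count n ((λ _ → true) ─ u)
    bound : d ℕ.+ d ℕ.* k ≤ fibre u ℕ.+ d ℕ.* k
    bound = begin
      d ℕ.+ d ℕ.* k                                  ≡⟨ ℕP.*-suc d k ⟨
      d ℕ.* suc k
        ≡⟨ cong (d ℕ.*_) (trans (sym (count-─ n {j = u} refl)) (count-full n)) ⟩
      d ℕ.* n                                        ≡⟨ ℕP.*-comm d n ⟩
      n ℕ.* d                                        ≡⟨ m≡nd ⟨
      m                                              ≡⟨ count-full m ⟨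
      count m (λ _ → true)                           ≡⟨ count-∘-─ m t {j = u} refl ⟩
      fibre u ℕ.+ count m (((λ _ → true) ─ u) ∘ t)   ≤⟨ ℕP.+-monoʳ-≤ (fibre u) (count-preimage-≤ fibre≤ _) ⟩
      fibre u ℕ.+ d ℕ.* k                            ∎
      where open ℕP.≤-Reasoning

enum : ∀ n (S : Subset n) → Fin (count n S) → Fin n
enum (suc n) S x with S zero
enum (suc n) S zero    | true  = zero
enum (suc n) S (suc x) | true  = suc (enum n (S ∘ suc) x)
enum (suc n) S x       | false = suc (enum n (S ∘ suc) x)

enum-∈ : ∀ n (S : Subset n) x → enum n S x ∈ S
enum-∈ (suc n) S x with S zero in eq
enum-∈ (suc n) S zero    | true  = eq
enum-∈ (suc n) S (suc x) | true  = enum-∈ n (S ∘ suc) x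
enum-∈ (suc n) S x       | false = enum-∈ n (S ∘ suc) x

enum-injective : ∀ n (S : Subset n) → Injective _≡_ _≡_ (enum n S)
enum-injective (suc n) S {x} {y} eq with S zero
enum-injective (suc n) S {zero}  {zero}  eq | true = refl
enum-injective (suc n) S {suc x} {suc y} eq | true =
  cong suc (enum-injective n (S ∘ suc) (FinP.suc-injective eq))
enum-injective (suc n) S {x} {y} eq | false = enum-injective n (S ∘ suc) (FinP.suc-injective eq)

count-injective-≤ : ∀ m {k} (S : Subset m) (g : Fin m → Fin k) →
                    (∀ {x y} → x ∈ S → y ∈ S → g x ≡ g y → x ≡ y) → count m S ≤ k
count-injective-≤ m S g g-inj = FinP.injective⇒≤ {f = g ∘ enum m S}
  (λ {x} {y} eq → enum-injective m S (g-inj (enum-∈ m S x) (enum-∈ m S y) eq))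

-- Rationals and finite sums

x-y≡0⇒x≡y : ∀ {x y} → x - y ≡ 0ℚ → x ≡ y
x-y≡0⇒x≡y {x} {y} x-y≡0 = begin
  x               ≡⟨ solve 2 (λ x y → x := (x :- y) :+ y) refl x y ⟩
  (x - y) + y     ≡⟨ cong (_+ y) x-y≡0 ⟩
  0ℚ + y          ≡⟨ ℚP.+-identityˡ y ⟩
  y               ∎
  where open ≡-Reasoning

recip : ∀ x → x ≢ 0ℚ → ℚ
recip x x≢0 = (1/ x) {{≢-nonZero x≢0}}

recip-inverseˡ : ∀ x (x≢0 : x ≢ 0ℚ) → recip x x≢0 * x ≡ 1ℚ
recip-inverseˡ x x≢0 = ℚP.*-inverseˡ x {{≢-nonZero x≢0}}

*-cancelˡ-≡0 : ∀ x y → x ≢ 0ℚ → x * y ≡ 0ℚ → y ≡ 0ℚ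
*-cancelˡ-≡0 x y x≢0 xy≡0 = begin
  y                  ≡⟨ ℚP.*-identityˡ y ⟨
  1ℚ * y             ≡⟨ cong (_* y) (recip-inverseˡ x x≢0) ⟨
  x⁻¹ * x * y        ≡⟨ ℚP.*-assoc x⁻¹ x y ⟩
  x⁻¹ * (x * y)      ≡⟨ cong (x⁻¹ *_) xy≡0 ⟩
  x⁻¹ * 0ℚ           ≡⟨ ℚP.*-zeroʳ x⁻¹ ⟩
  0ℚ                 ∎
  where
  open ≡-Reasoning
  x⁻¹ = recip x x≢0

sumFin-cong : ∀ n {f g : Fin n → ℚ} → (∀ i → f i ≡ g i) → sumFin n f ≡ sumFin n g
sumFin-cong zero    f≗g = refl
sumFin-cong (suc n) f≗g = cong₂ _+_ (f≗g zero) (sumFin-cong n (f≗g ∘ suc))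

sumFin-zero : ∀ n → sumFin n (λ _ → 0ℚ) ≡ 0ℚ
sumFin-zero zero    = refl
sumFin-zero (suc n) = trans (ℚP.+-identityˡ _) (sumFin-zero n)

sumFin-+ : ∀ n (f g : Fin n → ℚ) → sumFin n (λ i → f i + g i) ≡ sumFin n f + sumFin n g
sumFin-+ zero    f g = sym (ℚP.+-identityˡ 0ℚ)
sumFin-+ (suc n) f g = begin
  (f zero + g zero) + sumFin n (λ i → f (suc i) + g (suc i))
    ≡⟨ cong (f zero + g zero +_) (sumFin-+ n (f ∘ suc) (g ∘ suc)) ⟩
  (f zero + g zero) + (sumFin n (f ∘ suc) + sumFin n (g ∘ suc))
    ≡⟨ solve 4 (λ a b c d → (a :+ b) :+ (c :+ d) := (a :+ c) :+ (b :+ d)) refl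
         (f zero) (g zero) (sumFin n (f ∘ suc)) (sumFin n (g ∘ suc)) ⟩
  (f zero + sumFin n (f ∘ suc)) + (g zero + sumFin n (g ∘ suc)) ∎
  where open ≡-Reasoning

sumFin-*ˡ : ∀ n c (f : Fin n → ℚ) → c * sumFin n f ≡ sumFin n (λ i → c * f i)
sumFin-*ˡ zero    c f = ℚP.*-zeroʳ c
sumFin-*ˡ (suc n) c f =
  trans (ℚP.*-distribˡ-+ c (f zero) _) (cong (c * f zero +_) (sumFin-*ˡ n c (f ∘ suc)))

sumFin-comm : ∀ n k (f : Fin n → Fin k → ℚ) →
  sumFin n (λ i → sumFin k (f i)) ≡ sumFin k (λ j → sumFin n (λ i → f i j))
sumFin-comm zero    k f = sym (sumFin-zero k)
sumFin-comm (suc n) k f =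
  trans (cong (sumFin k (f zero) +_) (sumFin-comm n k (f ∘ suc)))
        (sym (sumFin-+ k (f zero) (λ j → sumFin n (λ i → f (suc i) j))))

sumFin-pick : ∀ n (f : Fin n → ℚ) j → sumFin n (λ i → if i ==F j then f i else 0ℚ) ≡ f j
sumFin-pick (suc n) f zero    = trans (cong (f zero +_) (sumFin-zero n)) (ℚP.+-identityʳ (f zero))
sumFin-pick (suc n) f (suc j) = trans (ℚP.+-identityˡ _) (sumFin-pick n (f ∘ suc) j)

if-sumFin : ∀ m a (g : Fin m → ℚ) →
            (if a then sumFin m g else 0ℚ) ≡ sumFin m (λ j → if a then g j else 0ℚ)
if-sumFin m true  g = refl
if-sumFin m false g = sym (sumFin-zero m)

sumOn-cong : ∀ n (S : Subset n) {f g : Fin n → ℚ} → (∀ i → i ∈ S → f i ≡ g i) →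
             sumOn n S f ≡ sumOn n S g
sumOn-cong n S {f} {g} f≗g = sumFin-cong n pointwise
  where
  pointwise : ∀ i → (if S i then f i else 0ℚ) ≡ (if S i then g i else 0ℚ)
  pointwise i with S i in i∈S
  ... | true  = f≗g i i∈S
  ... | false = refl

sumOn-zero : ∀ n (S : Subset n) {f : Fin n → ℚ} → (∀ i → i ∈ S → f i ≡ 0ℚ) → sumOn n S f ≡ 0ℚ
sumOn-zero n S f≗0 = trans (sumOn-cong n S f≗0) (trans (sumFin-cong n pointwise) (sumFin-zero n))
  where
  pointwise : ∀ i → (if S i then 0ℚ else 0ℚ) ≡ 0ℚ
  pointwise i with S i
  ... | true  = refl
  ... | false = refl

sumOn-+ : ∀ n (S : Subset n) (f g : Fin n → ℚ) →
          sumOn n S (λ i → f i + g i) ≡ sumOn n S f + sumOn n S g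
sumOn-+ n S f g = trans (sumFin-cong n pointwise) (sumFin-+ n _ _)
  where
  pointwise : ∀ i → (if S i then f i + g i else 0ℚ) ≡
                    (if S i then f i else 0ℚ) + (if S i then g i else 0ℚ)
  pointwise i with S i
  ... | true  = refl
  ... | false = sym (ℚP.+-identityˡ 0ℚ)

sumOn-*ˡ : ∀ n (S : Subset n) c (f : Fin n → ℚ) → c * sumOn n S f ≡ sumOn n S (λ i → c * f i)
sumOn-*ˡ n S c f = trans (sumFin-*ˡ n c _) (sumFin-cong n pointwise)
  where
  pointwise : ∀ i → c * (if S i then f i else 0ℚ) ≡ (if S i then c * f i else 0ℚ)
  pointwise i with S i
  ... | true  = refl
  ... | false = ℚP.*-zeroʳ c

sumOn-*ʳ : ∀ n (S : Subset n) c (f : Fin n → ℚ) → sumOn n S f * c ≡ sumOn n S (λ i → f i * c)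
sumOn-*ʳ n S c f = trans (ℚP.*-comm _ c)
  (trans (sumOn-*ˡ n S c f) (sumOn-cong n S (λ i _ → ℚP.*-comm c (f i))))

neg-sumOn : ∀ n (S : Subset n) (f : Fin n → ℚ) → sumOn n S (λ i → - f i) ≡ - sumOn n S f
neg-sumOn n S f = begin
  sumOn n S (λ i → - f i)
    ≡⟨ sumOn-cong n S (λ i _ → solve 1 (λ x → :- x := con (- 1ℚ) :* x) refl (f i)) ⟩
  sumOn n S (λ i → - 1ℚ * f i)     ≡⟨ sumOn-*ˡ n S (- 1ℚ) f ⟨
  - 1ℚ * sumOn n S f               ≡⟨ solve 1 (λ x → con (- 1ℚ) :* x := :- x) refl (sumOn n S f) ⟩
  - sumOn n S f                    ∎
  where open ≡-Reasoning

sumOn-comm : ∀ n k (S : Subset n) (T : Subset k) (f : Fin n → Fin k → ℚ) →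
  sumOn n S (λ i → sumOn k T (f i)) ≡ sumOn k T (λ j → sumOn n S (λ i → f i j))
sumOn-comm n k S T f = begin
  sumOn n S (λ i → sumOn k T (f i))
    ≡⟨ sumFin-cong n (λ i → if-sumFin k (S i) (λ j → if T j then f i j else 0ℚ)) ⟩
  sumFin n (λ i → sumFin k (λ j → masked (S i) (T j) i j))  ≡⟨ sumFin-comm n k _ ⟩
  sumFin k (λ j → sumFin n (λ i → masked (S i) (T j) i j))
    ≡⟨ sumFin-cong k (λ j → sumFin-cong n (λ i → masked-comm (S i) (T j))) ⟩
  sumFin k (λ j → sumFin n (λ i → masked (T j) (S i) i j))
    ≡⟨ sumFin-cong k (λ j → if-sumFin n (T j) (λ i → if S i then f i j else 0ℚ)) ⟨
  sumOn k T (λ j → sumOn n S (λ i → f i j))                 ∎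
  where
  open ≡-Reasoning
  masked : Bool → Bool → Fin n → Fin k → ℚ
  masked a b i j = if a then (if b then f i j else 0ℚ) else 0ℚ
  masked-comm : ∀ a b {i j} → masked a b i j ≡ masked b a i j
  masked-comm true  true  = refl
  masked-comm true  false = refl
  masked-comm false true  = refl
  masked-comm false false = refl

sumOn-assoc : ∀ m N (R : Subset m) (C : Subset N) (x : Fin m → ℚ) (M : Fin m → Fin N → ℚ) (z : Fin N → ℚ) →
  sumOn m R (λ r → x r * sumOn N C (λ c → M r c * z c)) ≡
  sumOn N C (λ c → sumOn m R (λ r → x r * M r c) * z c)
sumOn-assoc m N R C x M z = begin
  sumOn m R (λ r → x r * sumOn N C (λ c → M r c * z c))
    ≡⟨ sumOn-cong m R (λ r _ → sumOn-*ˡ N C (x r) _) ⟩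
  sumOn m R (λ r → sumOn N C (λ c → x r * (M r c * z c)))
    ≡⟨ sumOn-comm m N R C _ ⟩
  sumOn N C (λ c → sumOn m R (λ r → x r * (M r c * z c)))
    ≡⟨ sumOn-cong N C (λ c _ → sumOn-cong m R (λ r _ → ℚP.*-assoc (x r) (M r c) (z c))) ⟨
  sumOn N C (λ c → sumOn m R (λ r → x r * M r c * z c))
    ≡⟨ sumOn-cong N C (λ c _ → sumOn-*ʳ m R (z c) _) ⟨
  sumOn N C (λ c → sumOn m R (λ r → x r * M r c) * z c) ∎
  where open ≡-Reasoning

sumOn-pick : ∀ n (S : Subset n) (f : Fin n → ℚ) {j} → j ∈ S →
             sumOn n S (λ i → f i * δ (i ==F j)) ≡ f j
sumOn-pick n S f {j} j∈S = trans (sumFin-cong n pointwise) (sumFin-pick n f j)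
  where
  pointwise : ∀ i → (if S i then f i * δ (i ==F j) else 0ℚ) ≡ (if i ==F j then f i else 0ℚ)
  pointwise i with i Fin.≟ j
  ... | yes refl rewrite j∈S = ℚP.*-identityʳ (f i)
  ... | no _ with S i
  ...   | true  = ℚP.*-zeroʳ (f i)
  ...   | false = refl

sumOn-pick′ : ∀ n (S : Subset n) (f : Fin n → ℚ) {j} → j ∈ S →
              sumOn n S (λ i → δ (j ==F i) * f i) ≡ f j
sumOn-pick′ n S f {j} j∈S =
  trans (sumOn-cong n S (λ i _ → trans (ℚP.*-comm _ (f i)) (cong (λ b → f i * δ b) (==F-sym j i))))
        (sumOn-pick n S f j∈S)

sumOn-─ : ∀ n (S : Subset n) (f : Fin n → ℚ) {j} → j ∈ S → sumOn n S f ≡ f j + sumOn n (S ─ j) f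
sumOn-─ n S f {j} j∈S = begin
  sumOn n S f                                                     ≡⟨ sumFin-cong n pointwise ⟩
  sumFin n (λ i → (if i ==F j then f i else 0ℚ) + (if (S ─ j) i then f i else 0ℚ))
                                                                  ≡⟨ sumFin-+ n _ _ ⟩
  sumFin n (λ i → if i ==F j then f i else 0ℚ) + sumOn n (S ─ j) f ≡⟨ cong (_+ sumOn n (S ─ j) f) (sumFin-pick n f j) ⟩
  f j + sumOn n (S ─ j) f                                         ∎
  where
  open ≡-Reasoning
  pointwise : ∀ i → (if S i then f i else 0ℚ) ≡
                    (if i ==F j then f i else 0ℚ) + (if (S ─ j) i then f i else 0ℚ)
  pointwise i with i Fin.≟ j
  ... | yes refl rewrite j∈S = sym (ℚP.+-identityʳ (f i))
  ... | no _ with S i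
  ...   | true  = sym (ℚP.+-identityˡ (f i))
  ...   | false = sym (ℚP.+-identityˡ 0ℚ)

sumOn-enum : ∀ n (S : Subset n) (f : Fin n → ℚ) → sumOn n S f ≡ sumFin (count n S) (f ∘ enum n S)
sumOn-enum zero    S f = refl
sumOn-enum (suc n) S f with S zero
... | true  = cong (f zero +_) (sumOn-enum n (S ∘ suc) (f ∘ suc))
... | false = trans (ℚP.+-identityˡ _) (sumOn-enum n (S ∘ suc) (f ∘ suc))

-- Linear algebra of submatrices cut out by row and column subsets

Matrix : ℕ → ℕ → Set
Matrix m N = Fin m → Fin N → ℚ

transpose : ∀ {m N} → Matrix m N → Matrix N m
transpose M c r = M r c

lincomb : ∀ {m N} → Matrix m N → Subset m → (Fin m → ℚ) → Fin N → ℚ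
lincomb {m} M R l c = sumOn m R (λ r → l r * M r c)

_[_≔_] : ∀ {m} → (Fin m → ℚ) → Fin m → ℚ → Fin m → ℚ
(l [ r₀ ≔ α ]) r = if r ==F r₀ then α else l r

≔-other : ∀ {m} (l : Fin m → ℚ) {r₀ α r} → r ≢ r₀ → (l [ r₀ ≔ α ]) r ≡ l r
≔-other l r≢r₀ rewrite ==F-false r≢r₀ = refl

lincomb-≔ : ∀ {m N} (M : Matrix m N) R {r₀} → r₀ ∈ R → ∀ l α c →
            lincomb M R (l [ r₀ ≔ α ]) c ≡ α * M r₀ c + lincomb M (R ─ r₀) l c
lincomb-≔ {m} M R {r₀} r₀∈R l α c = trans (sumOn-─ m R _ r₀∈R) (cong₂ _+_
  (cong (λ b → (if b then α else l r₀) * M r₀ c) (==F-refl r₀))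
  (sumOn-cong m (R ─ r₀) (λ x x∈ → cong (_* M x c) (≔-other l (proj₂ (∈-─⁻ {S = R} x∈))))))

module _ {m N : ℕ} (M : Matrix m N) (R : Subset m) (C : Subset N) where

  Independent : Set
  Independent = ∀ l → (∀ c → c ∈ C → lincomb M R l c ≡ 0ℚ) → ∀ r → r ∈ R → l r ≡ 0ℚ

  Dependent : Set
  Dependent = Σ (Fin m → ℚ) λ l →
    (∃[ r ] (r ∈ R × l r ≢ 0ℚ)) × (∀ c → c ∈ C → lincomb M R l c ≡ 0ℚ)

  NonSingular : Set
  NonSingular = count m R ≡ count N C × Independent

  IsInverse : Matrix N m → Set
  IsInverse B =
    (∀ r r′ → r ∈ R → r′ ∈ R → sumOn N C (λ c → M r c * B c r′) ≡ δ (r ==F r′)) ×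
    (∀ c c′ → c ∈ C → c′ ∈ C → sumOn m R (λ r → B c r * M r c′) ≡ δ (c ==F c′))

pivot? : ∀ {m N} (M : Matrix m N) (R : Subset m) c →
         (∃[ r ] (r ∈ R × M r c ≢ 0ℚ)) ⊎ (∀ r → r ∈ R → M r c ≡ 0ℚ)
pivot? M R c with FinP.any? (λ r → (R r Bool.≟ true) ×-dec ¬? (M r c ℚP.≟ 0ℚ))
... | yes found = inj₁ found
... | no none = inj₂ (λ r r∈R → decidable-stable (M r c ℚP.≟ 0ℚ) (λ ≢0 → none (r , r∈R , ≢0)))

module _ {m N : ℕ} where

  dependent-zero-column : ∀ (M : Matrix m N) R C {c₀} → (∀ r → r ∈ R → M r c₀ ≡ 0ℚ) →
                          Dependent M R (C ─ c₀) → Dependent M R C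
  dependent-zero-column M R C {c₀} col≡0 (l , l≢0 , l·M≡0) = l , l≢0 , l·M≡0′
    where
    l·M≡0′ : ∀ c → c ∈ C → lincomb M R l c ≡ 0ℚ
    l·M≡0′ c c∈C with c Fin.≟ c₀
    ... | yes refl = sumOn-zero m R (λ r r∈R → trans (cong (l r *_) (col≡0 r r∈R)) (ℚP.*-zeroʳ (l r)))
    ... | no c≢c₀  = l·M≡0 c (∈-─⁺ {S = C} c∈C c≢c₀)

  eliminate : (M : Matrix m N) (r₀ : Fin m) (c₀ : Fin N) → M r₀ c₀ ≢ 0ℚ → Matrix m N
  eliminate M r₀ c₀ piv r c = M r c - (M r c₀ * recip (M r₀ c₀) piv) * M r₀ c

  eliminate-pivotColumn : ∀ M r₀ c₀ (piv : M r₀ c₀ ≢ 0ℚ) r → eliminate M r₀ c₀ piv r c₀ ≡ 0ℚ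
  eliminate-pivotColumn M r₀ c₀ piv r = begin
    M r c₀ - (M r c₀ * p⁻¹) * M r₀ c₀   ≡⟨ cong (λ x → M r c₀ - x) (ℚP.*-assoc (M r c₀) p⁻¹ (M r₀ c₀)) ⟩
    M r c₀ - M r c₀ * (p⁻¹ * M r₀ c₀)   ≡⟨ cong (λ x → M r c₀ - M r c₀ * x) (recip-inverseˡ (M r₀ c₀) piv) ⟩
    M r c₀ - M r c₀ * 1ℚ                ≡⟨ cong (λ x → M r c₀ - x) (ℚP.*-identityʳ (M r c₀)) ⟩
    M r c₀ - M r c₀                     ≡⟨ ℚP.+-inverseʳ (M r c₀) ⟩
    0ℚ                                  ∎
    where
    open ≡-Reasoning
    p⁻¹ = recip (M r₀ c₀) piv

  lincomb-eliminate : ∀ M {r₀ c₀} (piv : M r₀ c₀ ≢ 0ℚ) R l c →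
    lincomb (eliminate M r₀ c₀ piv) R l c ≡
    lincomb M R l c + (- (recip (M r₀ c₀) piv * M r₀ c)) * lincomb M R l c₀
  lincomb-eliminate M {r₀} {c₀} piv R l c = begin
    lincomb (eliminate M r₀ c₀ piv) R l c
      ≡⟨ sumOn-cong m R (λ x _ → solve 5
           (λ L a b i z → L :* (a :- (b :* i) :* z) := L :* a :+ (:- (i :* z)) :* (L :* b))
           refl (l x) (M x c) (M x c₀) p⁻¹ (M r₀ c)) ⟩
    sumOn m R (λ x → l x * M x c + (- (p⁻¹ * M r₀ c)) * (l x * M x c₀))
      ≡⟨ sumOn-+ m R _ _ ⟩
    lincomb M R l c + sumOn m R (λ x → (- (p⁻¹ * M r₀ c)) * (l x * M x c₀))
      ≡⟨ cong (lincomb M R l c +_) (sumOn-*ˡ m R (- (p⁻¹ * M r₀ c)) (λ x → l x * M x c₀)) ⟨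
    lincomb M R l c + (- (p⁻¹ * M r₀ c)) * lincomb M R l c₀ ∎
    where
    open ≡-Reasoning
    p⁻¹ = recip (M r₀ c₀) piv

  -- A relation l′ among the eliminated rows lifts to l′ [ r₀ ≔ α ], with α cancelling column c₀.
  dependent-eliminate : ∀ (M : Matrix m N) R C {r₀ c₀} (piv : M r₀ c₀ ≢ 0ℚ) → r₀ ∈ R →
                        Dependent (eliminate M r₀ c₀ piv) (R ─ r₀) (C ─ c₀) → Dependent M R C
  dependent-eliminate M R C {r₀} {c₀} piv r₀∈R (l′ , (r , r∈R─r₀ , l′r≢0) , l′·M′≡0) =
    l , (r , proj₁ r∈R×r≢r₀ , subst (_≢ 0ℚ) (sym (≔-other l′ (proj₂ r∈R×r≢r₀))) l′r≢0) , l·M≡0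
    where
    r∈R×r≢r₀ = ∈-─⁻ {S = R} r∈R─r₀
    S₀ = lincomb M (R ─ r₀) l′ c₀
    p⁻¹ = recip (M r₀ c₀) piv
    l : Fin m → ℚ
    l = l′ [ r₀ ≔ - (S₀ * p⁻¹) ]
    lincomb≡ : ∀ c → lincomb M R l c ≡ lincomb (eliminate M r₀ c₀ piv) (R ─ r₀) l′ c
    lincomb≡ c = begin
      lincomb M R l c                                       ≡⟨ lincomb-≔ M R r₀∈R l′ _ c ⟩
      - (S₀ * p⁻¹) * M r₀ c + lincomb M (R ─ r₀) l′ c
        ≡⟨ solve 4 (λ s i z t → (:- (s :* i)) :* z :+ t := t :+ (:- (i :* z)) :* s) refl
             S₀ p⁻¹ (M r₀ c) (lincomb M (R ─ r₀) l′ c) ⟩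
      lincomb M (R ─ r₀) l′ c + (- (p⁻¹ * M r₀ c)) * S₀     ≡⟨ lincomb-eliminate M piv (R ─ r₀) l′ c ⟨
      lincomb (eliminate M r₀ c₀ piv) (R ─ r₀) l′ c         ∎
      where open ≡-Reasoning
    l·M≡0 : ∀ c → c ∈ C → lincomb M R l c ≡ 0ℚ
    l·M≡0 c c∈C with c Fin.≟ c₀
    ... | yes refl = trans (lincomb≡ c) (sumOn-zero m (R ─ r₀)
          (λ x _ → trans (cong (l′ x *_) (eliminate-pivotColumn M r₀ c₀ piv x)) (ℚP.*-zeroʳ (l′ x))))
    ... | no c≢c₀  = trans (lincomb≡ c) (l′·M′≡0 c (∈-─⁺ {S = C} c∈C c≢c₀))

  -- Gaussian elimination, one column at a time.
  moreRows⇒dependent : ∀ k (M : Matrix m N) R C → count N C ≡ k → k < count m R → Dependent M R C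
  moreRows⇒dependent zero M R C cC≡0 0<cR with count>0⇒nonempty m 0<cR
  ... | r , r∈R = (λ x → δ (x ==F r)) , (r , r∈R , δrr≢0) , no-columns
    where
    δrr≢0 : δ (r ==F r) ≢ 0ℚ
    δrr≢0 rewrite ==F-refl r = λ ()
    no-columns : ∀ c → c ∈ C → lincomb M R (λ x → δ (x ==F r)) c ≡ 0ℚ
    no-columns c c∈C = ⊥-elim (∈∉⇒⊥ {S = C} c∈C (count≡0⇒∉ N cC≡0 c))
  moreRows⇒dependent (suc k) M R C cC≡ k<cR
    with count>0⇒nonempty N (subst (0 <_) (sym cC≡) (s≤s z≤n))
  ... | c₀ , c₀∈C with pivot? M R c₀
  ...   | inj₂ col≡0 = dependent-zero-column M R C col≡0
                         (moreRows⇒dependent k M R (C ─ c₀) cC─c₀≡k (ℕP.<-trans (ℕP.n<1+n k) k<cR))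
    where cC─c₀≡k = ℕP.suc-injective (trans (sym (count-─ N c₀∈C)) cC≡)
  ...   | inj₁ (r₀ , r₀∈R , piv) = dependent-eliminate M R C piv r₀∈R
                                     (moreRows⇒dependent k (eliminate M r₀ c₀ piv) (R ─ r₀) (C ─ c₀) cC─c₀≡k
                                        (ℕP.≤-pred (subst (suc k <_) (count-─ m r₀∈R) k<cR)))
    where cC─c₀≡k = ℕP.suc-injective (trans (sym (count-─ N c₀∈C)) cC≡)

module _ {m N : ℕ} {M : Matrix m N} {R : Subset m} {C : Subset N} where

  inverse-transpose : ∀ {B} → IsInverse M R C B → IsInverse (transpose M) C R (transpose B)
  inverse-transpose {B} (MB≡I , BM≡I) =
    (λ c c′ c∈C c′∈C → trans (sumOn-cong m R (λ r _ → ℚP.*-comm (M r c) (B c′ r)))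
                             (trans (BM≡I c′ c c′∈C c∈C) (cong δ (==F-sym c′ c)))) ,
    (λ r r′ r∈R r′∈R → trans (sumOn-cong N C (λ c _ → ℚP.*-comm (B c r) (M r′ c)))
                             (trans (MB≡I r′ r r′∈R r∈R) (cong δ (==F-sym r′ r))))

  inverse⇒independent : ∀ {B} → IsInverse M R C B → Independent M R C
  inverse⇒independent {B} (MB≡I , _) l l·M≡0 r′ r′∈R = begin
    l r′                                                      ≡⟨ sumOn-pick m R l r′∈R ⟨
    sumOn m R (λ r → l r * δ (r ==F r′))
      ≡⟨ sumOn-cong m R (λ r r∈R → cong (l r *_) (MB≡I r r′ r∈R r′∈R)) ⟨
    sumOn m R (λ r → l r * sumOn N C (λ c → M r c * B c r′))  ≡⟨ sumOn-assoc m N R C l M (λ c → B c r′) ⟩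
    sumOn N C (λ c → lincomb M R l c * B c r′)
      ≡⟨ sumOn-zero N C (λ c c∈C → trans (cong (_* B c r′) (l·M≡0 c c∈C)) (ℚP.*-zeroˡ (B c r′))) ⟩
    0ℚ                                                        ∎
    where open ≡-Reasoning

  -- A dependency of the rows of M augmented by the unit row at c₀ must use that row;
  -- solving for it expresses the unit row through the rows of M.
  nonSingular⇒leftInverseRow : NonSingular M R C → ∀ c₀ →
    Σ (Fin m → ℚ) λ z → ∀ c → c ∈ C → lincomb M R z c ≡ δ (c₀ ==F c)
  nonSingular⇒leftInverseRow (cR≡cC , indep) c₀ = z , z·M≡δ
    where
    M⁺ : Matrix (suc m) N
    M⁺ zero    c = δ (c₀ ==F c)
    M⁺ (suc r) c = M r c
    R⁺ : Subset (suc m)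
    R⁺ zero    = true
    R⁺ (suc r) = R r
    dep = moreRows⇒dependent (count N C) M⁺ R⁺ C refl (s≤s (ℕP.≤-reflexive (sym cR≡cC)))
    l = proj₁ dep
    l·M⁺≡0 : ∀ c → c ∈ C → l zero * δ (c₀ ==F c) + lincomb M R (l ∘ suc) c ≡ 0ℚ
    l·M⁺≡0 = proj₂ (proj₂ dep)
    l₀≢0 : l zero ≢ 0ℚ
    l₀≢0 l₀≡0 with proj₁ (proj₂ dep)
    ... | zero  , _     , l₀≢0 = l₀≢0 l₀≡0
    ... | suc r , r∈R , lr≢0 = lr≢0 (indep (l ∘ suc) l∘suc·M≡0 r r∈R)
      where
      l∘suc·M≡0 : ∀ c → c ∈ C → lincomb M R (l ∘ suc) c ≡ 0ℚ
      l∘suc·M≡0 c c∈C = begin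
        Y                ≡⟨ ℚP.+-identityˡ Y ⟨
        0ℚ + Y           ≡⟨ cong (_+ Y) (ℚP.*-zeroˡ Δ) ⟨
        0ℚ * Δ + Y       ≡⟨ cong (λ x → x * Δ + Y) l₀≡0 ⟨
        l zero * Δ + Y   ≡⟨ l·M⁺≡0 c c∈C ⟩
        0ℚ               ∎
        where
        open ≡-Reasoning
        Δ = δ (c₀ ==F c)
        Y = lincomb M R (l ∘ suc) c
    l₀⁻¹ = recip (l zero) l₀≢0
    z : Fin m → ℚ
    z r = (- l₀⁻¹) * l (suc r)
    z·M≡δ : ∀ c → c ∈ C → lincomb M R z c ≡ δ (c₀ ==F c)
    z·M≡δ c c∈C = begin
      lincomb M R z c
        ≡⟨ sumOn-cong m R (λ r _ → ℚP.*-assoc (- l₀⁻¹) (l (suc r)) (M r c)) ⟩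
      sumOn m R (λ r → - l₀⁻¹ * (l (suc r) * M r c)) ≡⟨ sumOn-*ˡ m R (- l₀⁻¹) _ ⟨
      - l₀⁻¹ * Y
        ≡⟨ solve 4 (λ i a d Y → (:- i) :* Y := (:- i) :* (a :* d :+ Y) :+ (i :* a) :* d) refl l₀⁻¹ (l zero) Δ Y ⟩
      - l₀⁻¹ * (l zero * Δ + Y) + l₀⁻¹ * l zero * Δ
        ≡⟨ cong₂ (λ x y → - l₀⁻¹ * x + y * Δ) (l·M⁺≡0 c c∈C) (recip-inverseˡ (l zero) l₀≢0) ⟩
      - l₀⁻¹ * 0ℚ + 1ℚ * Δ
        ≡⟨ solve 2 (λ i d → (:- i) :* con 0ℚ :+ con 1ℚ :* d := d) refl l₀⁻¹ Δ ⟩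
      Δ                                              ∎
      where
      open ≡-Reasoning
      Δ = δ (c₀ ==F c)
      Y = lincomb M R (l ∘ suc) c

  leftInverse⇒rightInverse : Independent M R C → ∀ {B} →
    (∀ c c′ → c ∈ C → c′ ∈ C → sumOn m R (λ r → B c r * M r c′) ≡ δ (c ==F c′)) →
    ∀ r r′ → r ∈ R → r′ ∈ R → sumOn N C (λ c → M r c * B c r′) ≡ δ (r ==F r′)
  leftInverse⇒rightInverse indep {B} BM≡I r r′ r∈R r′∈R = begin
    (MB r′)                        ≡⟨ solve 2 (λ x y → x := (x :- y) :+ y) refl (MB r′) (δ (r ==F r′)) ⟩
    l r′ + δ (r ==F r′)            ≡⟨ cong (_+ δ (r ==F r′)) (indep l l·M≡0 r′ r′∈R) ⟩
    0ℚ + δ (r ==F r′)              ≡⟨ ℚP.+-identityˡ _ ⟩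
    δ (r ==F r′)                   ∎
    where
    open ≡-Reasoning
    MB : Fin m → ℚ
    MB x = sumOn N C (λ c → M r c * B c x)
    l : Fin m → ℚ
    l x = MB x - δ (r ==F x)
    l·M≡0 : ∀ c′ → c′ ∈ C → lincomb M R l c′ ≡ 0ℚ
    l·M≡0 c′ c′∈C = begin
      lincomb M R l c′
        ≡⟨ sumOn-cong m R (λ x _ → ℚP.*-distribʳ-+ (M x c′) (MB x) (- δ (r ==F x))) ⟩
      sumOn m R (λ x → MB x * M x c′ + - δ (r ==F x) * M x c′)
        ≡⟨ sumOn-+ m R _ _ ⟩
      sumOn m R (λ x → MB x * M x c′) + sumOn m R (λ x → - δ (r ==F x) * M x c′)
        ≡⟨ cong₂ _+_ MB·M≡Mr (sumOn-cong m R (λ x _ → sym (ℚP.neg-distribˡ-* (δ (r ==F x)) (M x c′)))) ⟩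
      M r c′ + sumOn m R (λ x → - (δ (r ==F x) * M x c′))
        ≡⟨ cong (M r c′ +_) (neg-sumOn m R _) ⟩
      M r c′ - sumOn m R (λ x → δ (r ==F x) * M x c′)
        ≡⟨ cong (λ y → M r c′ - y) (sumOn-pick′ m R (λ x → M x c′) r∈R) ⟩
      M r c′ - M r c′
        ≡⟨ ℚP.+-inverseʳ (M r c′) ⟩
      0ℚ ∎
      where
      MB·M≡Mr : sumOn m R (λ x → MB x * M x c′) ≡ M r c′
      MB·M≡Mr = trans (sym (sumOn-assoc N m C R (M r) B (λ x → M x c′)))
                      (trans (sumOn-cong N C (λ c c∈C → cong (M r c *_) (BM≡I c c′ c∈C c′∈C)))
                             (sumOn-pick N C (M r) c′∈C))

  nonSingular⇒inverse : NonSingular M R C → Σ (Matrix N m) (IsInverse M R C)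
  nonSingular⇒inverse ns = B , leftInverse⇒rightInverse (proj₂ ns) BM≡I , BM≡I
    where
    B : Matrix N m
    B c = proj₁ (nonSingular⇒leftInverseRow ns c)
    BM≡I : ∀ c c′ → c ∈ C → c′ ∈ C → sumOn m R (λ r → B c r * M r c′) ≡ δ (c ==F c′)
    BM≡I c c′ _ c′∈C = proj₂ (nonSingular⇒leftInverseRow ns c) c′ c′∈C

  independent-restrict : Independent M (λ _ → true) (λ _ → true) →
    (∀ r → r ∈ R → ∀ c → c ∉ C → M r c ≡ 0ℚ) → Independent M R C
  independent-restrict indep outside≡0 l l·M≡0 r r∈R =
    trans (sym (cong (λ b → if b then l r else 0ℚ) r∈R)) (indep l̂ l̂·M≡0 r refl)
    where
    l̂ : Fin m → ℚ
    l̂ r = if R r then l r else 0ℚ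
    l̂·M≡l·M : ∀ c → lincomb M (λ _ → true) l̂ c ≡ lincomb M R l c
    l̂·M≡l·M c = sumFin-cong m pointwise
      where
      pointwise : ∀ r → l̂ r * M r c ≡ (if R r then l r * M r c else 0ℚ)
      pointwise r with R r
      ... | true  = refl
      ... | false = ℚP.*-zeroˡ (M r c)
    l̂·M≡0 : ∀ c → c ∈ (λ _ → true) → lincomb M (λ _ → true) l̂ c ≡ 0ℚ
    l̂·M≡0 c _ with C c in c∈?C
    ... | true  = trans (l̂·M≡l·M c) (l·M≡0 c c∈?C)
    ... | false = trans (l̂·M≡l·M c) (sumOn-zero m R (λ r r∈R →
                    trans (cong (l r *_) (outside≡0 r r∈R c c∈?C)) (ℚP.*-zeroʳ (l r))))

module _ {m N : ℕ} {M : Matrix m N} {R : Subset m} {C : Subset N} where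

  -- Pairing a relation among the remaining rows with μ shows that it also vanishes at column c.
  independent-minor : Independent M R C → ∀ {r₀} → r₀ ∈ R → ∀ (μ : Fin N → ℚ) {c} → c ∈ C → μ c ≢ 0ℚ →
    (∀ r → r ∈ R ─ r₀ → sumOn N C (λ y → μ y * M r y) ≡ 0ℚ) → Independent M (R ─ r₀) (C ─ c)
  independent-minor indep {r₀} r₀∈R μ {c} c∈C μc≢0 μM≡0 l l·M≡0 r r∈R─r₀ =
    trans (sym l̂r≡lr) (indep l̂ l̂·M≡0 r (proj₁ (∈-─⁻ {S = R} r∈R─r₀)))
    where
    l̂ : Fin m → ℚ
    l̂ = l [ r₀ ≔ 0ℚ ]
    l̂r≡lr : l̂ r ≡ l r
    l̂r≡lr = ≔-other l (proj₂ (∈-─⁻ {S = R} r∈R─r₀))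
    l̂·M≡l·M : ∀ c′ → lincomb M R l̂ c′ ≡ lincomb M (R ─ r₀) l c′
    l̂·M≡l·M c′ = trans (lincomb-≔ M R r₀∈R l 0ℚ c′)
      (trans (cong (_+ lincomb M (R ─ r₀) l c′) (ℚP.*-zeroˡ (M r₀ c′))) (ℚP.+-identityˡ _))
    l·M-at-c : lincomb M (R ─ r₀) l c ≡ 0ℚ
    l·M-at-c = *-cancelˡ-≡0 (μ c) _ μc≢0 (begin
      μ c * lMc                                                      ≡⟨ ℚP.*-comm (μ c) lMc ⟩
      lMc * μ c                                                      ≡⟨ ℚP.+-identityʳ _ ⟨
      lMc * μ c + 0ℚ
        ≡⟨ cong (lMc * μ c +_) (sumOn-zero N (C ─ c)
           (λ y y∈ → trans (cong (_* μ y) (l·M≡0 y y∈)) (ℚP.*-zeroˡ (μ y)))) ⟨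
      lMc * μ c + sumOn N (C ─ c) (λ y → lincomb M (R ─ r₀) l y * μ y) ≡⟨ sumOn-─ N C _ c∈C ⟨
      sumOn N C (λ y → lincomb M (R ─ r₀) l y * μ y)                 ≡⟨ sumOn-assoc m N (R ─ r₀) C l M μ ⟨
      sumOn m (R ─ r₀) (λ x → l x * sumOn N C (λ y → M x y * μ y))   ≡⟨ sumOn-zero m (R ─ r₀) (λ x x∈ →
           trans (cong (l x *_) (trans (sumOn-cong N C (λ y _ → ℚP.*-comm (M x y) (μ y))) (μM≡0 x x∈)))
                 (ℚP.*-zeroʳ (l x))) ⟩
      0ℚ                                                             ∎)
      where
      open ≡-Reasoning
      lMc = lincomb M (R ─ r₀) l c
    l̂·M≡0 : ∀ c′ → c′ ∈ C → lincomb M R l̂ c′ ≡ 0ℚ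
    l̂·M≡0 c′ c′∈C with c′ Fin.≟ c
    ... | yes refl = trans (l̂·M≡l·M c′) l·M-at-c
    ... | no c′≢c  = trans (l̂·M≡l·M c′) (l·M≡0 c′ (∈-─⁺ {S = C} c′∈C c′≢c))

  -- The analogue of Laplace expansion along row r₀.
  nonSingular-─ : NonSingular M R C → ∀ {r₀} → r₀ ∈ R →
    Σ (Fin N) λ c → c ∈ C × M r₀ c ≢ 0ℚ × NonSingular M (R ─ r₀) (C ─ c)
  nonSingular-─ ns@(cR≡cC , indep) {r₀} r₀∈R
    with moreRows⇒dependent (count m (R ─ r₀)) (transpose M) C (R ─ r₀) refl
           (subst (_≤ count N C) (count-─ m r₀∈R) (ℕP.≤-reflexive cR≡cC))
  ... | μ , (c* , c*∈C , μc*≢0) , μM≡0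
    with FinP.any? (λ c → (C c Bool.≟ true) ×-dec ¬? (μ c ℚP.≟ 0ℚ) ×-dec ¬? (M r₀ c ℚP.≟ 0ℚ))
  ... | yes (c , c∈C , μc≢0 , Mr₀c≢0) =
    c , c∈C , Mr₀c≢0 ,
    ℕP.suc-injective (trans (sym (count-─ m r₀∈R)) (trans cR≡cC (count-─ N c∈C))) ,
    independent-minor indep r₀∈R μ c∈C μc≢0 μM≡0
  ... | no none = ⊥-elim (μc*≢0 (columnsIndependent μ μM≡0′ c* c*∈C))
    where
    columnsIndependent : Independent (transpose M) C R
    columnsIndependent =
      inverse⇒independent {M = transpose M} (inverse-transpose {M = M} (proj₂ (nonSingular⇒inverse ns)))
    μM≡0′ : ∀ r → r ∈ R → lincomb (transpose M) C μ r ≡ 0ℚ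
    μM≡0′ r r∈R with r Fin.≟ r₀
    ... | no r≢r₀  = μM≡0 r (∈-─⁺ {S = R} r∈R r≢r₀)
    ... | yes refl = sumOn-zero N C term≡0
      where
      term≡0 : ∀ c → c ∈ C → μ c * M r c ≡ 0ℚ
      term≡0 c c∈C with μ c ℚP.≟ 0ℚ | M r c ℚP.≟ 0ℚ
      ... | yes μc≡0 | _         = trans (cong (_* M r c) μc≡0) (ℚP.*-zeroˡ (M r c))
      ... | no _     | yes Mrc≡0 = trans (cong (μ c *_) Mrc≡0) (ℚP.*-zeroʳ (μ c))
      ... | no μc≢0  | no Mrc≢0  = ⊥-elim (none (c , c∈C , μc≢0 , Mrc≢0))

module _ {m N : ℕ} {M : Matrix m N} where

  Transversal : Subset m → Subset N → Set
  Transversal R C = Σ (Fin m → Fin N) λ f →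
    (∀ r → r ∈ R → f r ∈ C × M r (f r) ≢ 0ℚ) × (∀ {r r′} → r ∈ R → r′ ∈ R → f r ≡ f r′ → r ≡ r′)

  -- f₀ only supplies the (irrelevant) values outside R.
  nonSingular⇒transversal : (f₀ : Fin m → Fin N) → ∀ k {R C} → count m R ≡ k →
                            NonSingular M R C → Transversal R C
  nonSingular⇒transversal f₀ zero {R} cR≡0 _ =
    f₀ , (λ r r∈R → ⊥-elim (∈∉⇒⊥ {S = R} r∈R (count≡0⇒∉ m cR≡0 r))) ,
         (λ {r} r∈R _ _ → ⊥-elim (∈∉⇒⊥ {S = R} r∈R (count≡0⇒∉ m cR≡0 r)))
  nonSingular⇒transversal f₀ (suc k) {R} {C} cR≡ ns
    with count>0⇒nonempty m (subst (0 <_) (sym cR≡) (s≤s z≤n))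
  ... | r₀ , r₀∈R with nonSingular-─ ns r₀∈R
  ... | c , c∈C , Mr₀c≢0 , ns′
    with nonSingular⇒transversal f₀ k (ℕP.suc-injective (trans (sym (count-─ m r₀∈R)) cR≡)) ns′
  ... | f′ , f′-good , f′-injective = f , f-good , f-injective
    where
    f : Fin m → Fin N
    f r = if r ==F r₀ then c else f′ r
    f′-off : ∀ {r} → r ∈ R → r ≢ r₀ → f′ r ∈ C ─ c × M r (f′ r) ≢ 0ℚ
    f′-off r∈R r≢r₀ = f′-good _ (∈-─⁺ {S = R} r∈R r≢r₀)
    f-good : ∀ r → r ∈ R → f r ∈ C × M r (f r) ≢ 0ℚ
    f-good r r∈R with r Fin.≟ r₀
    ... | yes refl = c∈C , Mr₀c≢0
    ... | no r≢r₀  = proj₁ (∈-─⁻ {S = C} (proj₁ (f′-off r∈R r≢r₀))) , proj₂ (f′-off r∈R r≢r₀)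
    f-injective : ∀ {r r′} → r ∈ R → r′ ∈ R → f r ≡ f r′ → r ≡ r′
    f-injective {r} {r′} r∈R r′∈R fr≡fr′ with r Fin.≟ r₀ | r′ Fin.≟ r₀
    ... | yes refl | yes refl = refl
    ... | yes refl | no r′≢r₀ = ⊥-elim (proj₂ (∈-─⁻ {S = C} (proj₁ (f′-off r′∈R r′≢r₀))) (sym fr≡fr′))
    ... | no r≢r₀  | yes refl = ⊥-elim (proj₂ (∈-─⁻ {S = C} (proj₁ (f′-off r∈R r≢r₀))) fr≡fr′)
    ... | no r≢r₀  | no r′≢r₀ = f′-injective (∈-─⁺ {S = R} r∈R r≢r₀) (∈-─⁺ {S = R} r′∈R r′≢r₀) fr≡fr′

  nonSingular⇒minor : ∀ t j {R C} → count m R ≡ t ℕ.+ j → NonSingular M R C →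
    Σ (Subset m) λ R′ → Σ (Subset N) λ C′ → count m R′ ≡ j × NonSingular M R′ C′
  nonSingular⇒minor zero    j {R} {C} cR≡ ns = R , C , cR≡ , ns
  nonSingular⇒minor (suc t) j {R} cR≡ ns with count>0⇒nonempty m (subst (0 <_) (sym cR≡) (s≤s z≤n))
  ... | r₀ , r₀∈R with nonSingular-─ ns r₀∈R
  ... | c , _ , _ , ns′ =
    nonSingular⇒minor t j (ℕP.suc-injective (trans (sym (count-─ m r₀∈R)) cR≡)) ns′

-- Flattening the d columns of each of n vertices into Fin (n * d)

count-++ : ∀ a b (f : Subset (a ℕ.+ b)) →
           count (a ℕ.+ b) f ≡ count a (f ∘ (Fin._↑ˡ b)) ℕ.+ count b (f ∘ (a Fin.↑ʳ_))
count-++ zero    b f = refl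
count-++ (suc a) b f =
  trans (cong ((if f zero then 1 else 0) ℕ.+_) (count-++ a b (f ∘ suc)))
        (sym (ℕP.+-assoc (if f zero then 1 else 0) _ _))

sumFin-++ : ∀ a b (f : Fin (a ℕ.+ b) → ℚ) →
            sumFin (a ℕ.+ b) f ≡ sumFin a (f ∘ (Fin._↑ˡ b)) + sumFin b (f ∘ (a Fin.↑ʳ_))
sumFin-++ zero    b f = sym (ℚP.+-identityˡ _)
sumFin-++ (suc a) b f = trans (cong (f zero +_) (sumFin-++ a b (f ∘ suc))) (sym (ℚP.+-assoc (f zero) _ _))

sumFin-combine : ∀ n d (f : Fin (n ℕ.* d) → ℚ) →
                 sumFin (n ℕ.* d) f ≡ sumFin n (λ i → sumFin d (λ a → f (combine i a)))
sumFin-combine zero    d f = refl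
sumFin-combine (suc n) d f =
  trans (sumFin-++ d (n ℕ.* d) f)
        (cong (sumFin d (f ∘ combine {suc n} {d} zero) +_) (sumFin-combine n d (f ∘ (d Fin.↑ʳ_))))

columnsOf : ∀ {n} d → Subset n → Subset (n ℕ.* d)
columnsOf {n} d S = S ∘ Fin.quotient {n} d

count-columnsOf : ∀ n d (S : Subset n) → count (n ℕ.* d) (columnsOf d S) ≡ d ℕ.* count n S
count-columnsOf zero    d S = sym (ℕP.*-zeroʳ d)
count-columnsOf (suc n) d S = begin
  count (d ℕ.+ n ℕ.* d) (columnsOf d S)
    ≡⟨ count-++ d (n ℕ.* d) (columnsOf d S) ⟩
  count d (λ a → S (Fin.quotient d (a Fin.↑ˡ n ℕ.* d))) ℕ.+
  count (n ℕ.* d) (λ k → S (Fin.quotient d (d Fin.↑ʳ k)))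
    ≡⟨ cong₂ ℕ._+_ (count-cong d (λ a → cong S (quotient-↑ˡ a)))
                   (count-cong (n ℕ.* d) (λ k → cong S (quotient-↑ʳ k))) ⟩
  count d (λ _ → S zero) ℕ.+ count (n ℕ.* d) (columnsOf d (S ∘ suc))
    ≡⟨ cong₂ ℕ._+_ (count-const (S zero)) (count-columnsOf n d (S ∘ suc)) ⟩
  (if S zero then d else 0) ℕ.+ d ℕ.* count n (S ∘ suc)
    ≡⟨ split (S zero) ⟩
  d ℕ.* count (suc n) S ∎
  where
  open ≡-Reasoning
  quotient-↑ˡ : ∀ a → Fin.quotient {suc n} d (a Fin.↑ˡ n ℕ.* d) ≡ zero
  quotient-↑ˡ a rewrite FinP.splitAt-↑ˡ d a (n ℕ.* d) = refl
  quotient-↑ʳ : ∀ k → Fin.quotient {suc n} d (d Fin.↑ʳ k) ≡ suc (Fin.quotient {n} d k)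
  quotient-↑ʳ k rewrite FinP.splitAt-↑ʳ d (n ℕ.* d) k = refl
  count-const : ∀ b → count d (λ _ → b) ≡ (if b then d else 0)
  count-const true  = count-full d
  count-const false = count-empty d (λ _ → refl)
  split : ∀ b → (if b then d else 0) ℕ.+ d ℕ.* count n (S ∘ suc) ≡
                d ℕ.* ((if b then 1 else 0) ℕ.+ count n (S ∘ suc))
  split true  = sym (ℕP.*-suc d _)
  split false = refl

sumOn-columnsOf : ∀ n d (S : Subset n) (g : Fin n × Fin d → ℚ) →
  sumOn (n ℕ.* d) (columnsOf d S) (g ∘ remQuot d) ≡ sumOn n S (λ i → sumFin d (λ a → g (i , a)))
sumOn-columnsOf n d S g = begin
  sumOn (n ℕ.* d) (columnsOf d S) (g ∘ remQuot d)
    ≡⟨ sumFin-combine n d _ ⟩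
  sumFin n (λ i → sumFin d (λ a →
    if S (Fin.quotient d (combine i a)) then g (remQuot d (combine i a)) else 0ℚ))
    ≡⟨ sumFin-cong n (λ i → sumFin-cong d (λ a →
         cong (λ ia → if S (proj₁ ia) then g ia else 0ℚ) (FinP.remQuot-combine i a))) ⟩
  sumFin n (λ i → sumFin d (λ a → if S i then g (i , a) else 0ℚ))
    ≡⟨ sumFin-cong n (λ i → if-sumFin d (S i) (λ a → g (i , a))) ⟨
  sumOn n S (λ i → sumFin d (λ a → g (i , a))) ∎
  where open ≡-Reasoning

==F-combine : ∀ {n d} (i j : Fin n) (a b : Fin d) →
              (combine i a ==F combine j b) ≡ ((i ==F j) ∧ (a ==F b))
==F-combine i j a b with i Fin.≟ j | a Fin.≟ b
... | yes refl | yes refl = ==F-refl (combine i a)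
... | yes refl | no a≢b   = ==F-false (a≢b ∘ proj₂ ∘ FinP.combine-injective i a j b)
... | no i≢j   | _        = ==F-false (i≢j ∘ proj₁ ∘ FinP.combine-injective i a j b)

==F-remQuot : ∀ {n} d (k k′ : Fin (n ℕ.* d)) →
  (k ==F k′) ≡ ((Fin.quotient {n} d k ==F Fin.quotient {n} d k′) ∧
                (Fin.remainder {n} d k ==F Fin.remainder {n} d k′))
==F-remQuot {n} d k k′ =
  trans (cong₂ _==F_ (sym (FinP.combine-remQuot {n} d k)) (sym (FinP.combine-remQuot {n} d k′)))
        (==F-combine (Fin.quotient {n} d k) (Fin.quotient {n} d k′)
                     (Fin.remainder {n} d k) (Fin.remainder {n} d k′))

remQuot-injective : ∀ {n} d → Injective _≡_ _≡_ (remQuot {n} d)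
remQuot-injective {n} d {k} {k′} eq =
  trans (sym (FinP.combine-remQuot {n} d k))
        (trans (cong (uncurry combine) eq) (FinP.combine-remQuot {n} d k′))

-- The pinned rigidity matrix

rigidityMatrix : (d : ℕ) (G : PinnedGraph) → Config d G → Matrix (m G) (nI G ℕ.* d)
rigidityMatrix d G p e k = rigidity d G p e (remQuot {nI G} d k)

module _ {d : ℕ} {G : PinnedGraph} {p : Config d G} {I : Subset (nI G)} {E : Subset (m G)} where

  squareInvertibleOn⇒inverse : SquareInvertibleOn d G p I E →
    Σ (Matrix (nI G ℕ.* d) (m G)) (IsInverse (rigidityMatrix d G p) E (columnsOf d I))
  squareInvertibleOn⇒inverse (_ , B , RB≡I , BR≡I) = B ∘ remQuot {nI G} d , RB′≡I , B′R≡I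
    where
    RB′≡I : ∀ e e′ → e ∈ E → e′ ∈ E →
      sumOn (nI G ℕ.* d) (columnsOf d I) (λ k → rigidityMatrix d G p e k * B (remQuot {nI G} d k) e′) ≡
      δ (e ==F e′)
    RB′≡I e e′ e∈E e′∈E =
      trans (sumOn-columnsOf (nI G) d I (λ c → rigidity d G p e c * B c e′)) (RB≡I e e′ e∈E e′∈E)
    B′R≡I : ∀ k k′ → k ∈ columnsOf d I → k′ ∈ columnsOf d I →
      sumOn (m G) E (λ e → B (remQuot {nI G} d k) e * rigidityMatrix d G p e k′) ≡ δ (k ==F k′)
    B′R≡I k k′ k∈ k′∈ = trans (BR≡I _ _ _ _ k∈ k′∈) (cong δ (sym (==F-remQuot {nI G} d k k′)))

  inverse⇒squareInvertibleOn : count (m G) E ≡ d ℕ.* count (nI G) I → ∀ {B} →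
    IsInverse (rigidityMatrix d G p) E (columnsOf d I) B → SquareInvertibleOn d G p I E
  inverse⇒squareInvertibleOn cE≡ {B} (RB≡I , BR≡I) = cE≡ , B′ , RB′≡I , B′R≡I
    where
    B′ : Col d G → Fin (m G) → ℚ
    B′ (i , a) = B (combine i a)
    RB′≡I : ∀ e e′ → e ∈ E → e′ ∈ E →
      sumOn (nI G) I (λ i → sumFin d (λ a → rigidity d G p e (i , a) * B′ (i , a) e′)) ≡
      δ (e ==F e′)
    RB′≡I e e′ e∈E e′∈E = begin
      sumOn (nI G) I (λ i → sumFin d (λ a → rigidity d G p e (i , a) * B′ (i , a) e′))
        ≡⟨ sumOn-columnsOf (nI G) d I (λ c → rigidity d G p e c * B′ c e′) ⟨
      sumOn (nI G ℕ.* d) (columnsOf d I) (λ k → rigidityMatrix d G p e k * B′ (remQuot {nI G} d k) e′)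
        ≡⟨ sumOn-cong (nI G ℕ.* d) (columnsOf d I) (λ k _ →
             cong (λ k′ → rigidityMatrix d G p e k * B k′ e′) (FinP.combine-remQuot {nI G} d k)) ⟩
      sumOn (nI G ℕ.* d) (columnsOf d I) (λ k → rigidityMatrix d G p e k * B k e′)
        ≡⟨ RB≡I e e′ e∈E e′∈E ⟩
      δ (e ==F e′) ∎
      where open ≡-Reasoning
    column∈ : ∀ {i} a → i ∈ I → combine {nI G} i a ∈ columnsOf d I
    column∈ {i} a i∈I = trans (cong (I ∘ proj₁) (FinP.remQuot-combine i a)) i∈I
    B′R≡I : ∀ i a j b → i ∈ I → j ∈ I →
      sumOn (m G) E (λ e → B′ (i , a) e * rigidity d G p e (j , b)) ≡ δ ((i ==F j) ∧ (a ==F b))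
    B′R≡I i a j b i∈I j∈I = begin
      sumOn (m G) E (λ e → B′ (i , a) e * rigidity d G p e (j , b))
        ≡⟨ sumOn-cong (m G) E (λ e _ →
             cong (λ c → B′ (i , a) e * rigidity d G p e c) (FinP.remQuot-combine j b)) ⟨
      sumOn (m G) E (λ e → B (combine i a) e * rigidityMatrix d G p e (combine j b))
        ≡⟨ BR≡I (combine i a) (combine j b) (column∈ a i∈I) (column∈ b j∈I) ⟩
      δ (combine i a ==F combine j b)
        ≡⟨ cong δ (==F-combine i j a b) ⟩
      δ ((i ==F j) ∧ (a ==F b)) ∎
      where open ≡-Reasoning

module _ {d : ℕ} {G : PinnedGraph} {p : Config d G} where

  private
    u = λ e → p (inj₁ (inner G e))
    w = λ e → p (other G e)

  rigidity≢0⇒endpoint : ∀ {e i a} → rigidity d G p e (i , a) ≢ 0ℚ →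
                        inner G e ≡ i ⊎ other G e ≡ inj₁ i
  rigidity≢0⇒endpoint {e} {i} nz with inner G e Fin.≟ i
  ... | yes inner≡i = inj₁ inner≡i
  ... | no _ with other G e | nz
  ...   | inj₁ j | nz′ with j Fin.≟ i
  ...     | yes refl = inj₂ refl
  ...     | no _     = ⊥-elim (nz′ (ℚP.+-identityˡ 0ℚ))
  rigidity≢0⇒endpoint {e} {i} nz | no _ | inj₂ k | nz′ = ⊥-elim (nz′ (ℚP.+-identityˡ 0ℚ))

  rigidity-inner : ∀ e a → rigidity d G p e (inner G e , a) ≡ u e a - w e a
  rigidity-inner e a rewrite ==F-refl (inner G e) with other G e in eq
  ... | inj₂ _ = ℚP.+-identityʳ _
  ... | inj₁ j rewrite ==F-false (λ (j≡inner : j ≡ inner G e) → distinct G e j eq (sym j≡inner)) =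
    ℚP.+-identityʳ _

  rigidity-other : ∀ e j a → other G e ≡ inj₁ j → rigidity d G p e (j , a) ≡ w e a - u e a
  rigidity-other e j a eq rewrite ==F-false (distinct G e j eq) | eq | ==F-refl j = ℚP.+-identityˡ _

  rigidity-coordinate≡0 : ∀ {e} i {a} → u e a ≡ w e a → rigidity d G p e (i , a) ≡ 0ℚ
  rigidity-coordinate≡0 {e} i {a} u≡w
    rewrite u≡w | ℚP.+-inverseʳ (w e a)
    with inner G e ==F i | other G e ==V inj₁ i
  ... | true  | true  = refl
  ... | true  | false = refl
  ... | false | true  = refl
  ... | false | false = refl

  -- A nonzero entry in coordinate a means the endpoints differ in that coordinate,
  -- which makes the entries of both inner endpoints in that coordinate nonzero.
  rigidity-endpoints≢0 : ∀ {e i a} → rigidity d G p e (i , a) ≢ 0ℚ →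
    ∀ {j} → inner G e ≡ j ⊎ other G e ≡ inj₁ j → rigidity d G p e (j , a) ≢ 0ℚ
  rigidity-endpoints≢0 {e} {i} {a} nz (inj₁ refl) entry≡0 =
    nz (rigidity-coordinate≡0 i (x-y≡0⇒x≡y (trans (sym (rigidity-inner e a)) entry≡0)))
  rigidity-endpoints≢0 {e} {i} {a} nz {j} (inj₂ eq) entry≡0 =
    nz (rigidity-coordinate≡0 i (sym (x-y≡0⇒x≡y (trans (sym (rigidity-other e j a eq)) entry≡0))))

-- Tight subgraphs

Tight : ℕ → (G : PinnedGraph) → Subgraph G → Set
Tight d G H = count (m G) (E' H) ≡ d ℕ.* count (nI G) (I' H)

edge-endpoint∈ : ∀ {G} (H : Subgraph G) {e j} → e ∈ E' H → inner G e ≡ j ⊎ other G e ≡ inj₁ j → j ∈ I' H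
edge-endpoint∈ H e∈E (inj₁ refl) = innerIn H _ e∈E
edge-endpoint∈ H e∈E (inj₂ eq)   = otherInnerIn H _ _ e∈E eq

subgraphIsostatic⇒tight : ∀ {d G} H → SubgraphIsostatic d G H → Tight d G H
subgraphIsostatic⇒tight H (_ , tight , _) = tight

module _ {d : ℕ} {G : PinnedGraph} where

  squareInvertible⇒nonSingular : ∀ {p} → SquareInvertibleOn d G p (λ _ → true) (λ _ → true) →
    NonSingular (rigidityMatrix d G p) (λ _ → true) (λ _ → true)
  squareInvertible⇒nonSingular {p} sio =
    trans (proj₁ sio) (sym (count-columnsOf (nI G) d (λ _ → true))) ,
    inverse⇒independent (proj₂ (squareInvertibleOn⇒inverse {d} {G} {p} sio))

  subgraphRows-outside≡0 : ∀ p (H : Subgraph G) e → e ∈ E' H → ∀ k → k ∉ columnsOf d (I' H) →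
                 rigidityMatrix d G p e k ≡ 0ℚ
  subgraphRows-outside≡0 p H e e∈E k k∉ = decidable-stable (rigidityMatrix d G p e k ℚP.≟ 0ℚ) λ nz →
    ∈∉⇒⊥ {S = I' H} (edge-endpoint∈ H e∈E (rigidity≢0⇒endpoint {d} {G} {p} nz)) k∉

  tight⇒subgraphIsostatic : PinnedIsostatic d G → ∀ H → Tight d G H → SubgraphIsostatic d G H
  tight⇒subgraphIsostatic (p₀ , sio) H tight =
    p₀ , inverse⇒squareInvertibleOn {d} {G} {p₀} tight (proj₂ (nonSingular⇒inverse ns))
    where
    ns : NonSingular (rigidityMatrix d G p₀) (E' H) (columnsOf d (I' H))
    ns = trans tight (sym (count-columnsOf (nI G) d (I' H))) ,
         independent-restrict (proj₂ (squareInvertible⇒nonSingular {p₀} sio)) (subgraphRows-outside≡0 p₀ H)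

-- Reachability in a finite digraph with decidable arcs

star-preserves : ∀ {A : Set} {T : A → A → Set} (P : A → Set) →
                 (∀ {x y} → T x y → P x → P y) → ∀ {x y} → Star T x y → P x → P y
star-preserves P pres = fold (λ x y → P x → P y) (λ t k → k ∘ pres t) id

module Reachability {n : ℕ} (A : Fin n → Fin n → Set) (A? : ∀ x y → Dec (A x y)) where

  Closed : Subset n → Set
  Closed S = ∀ {x y} → A x y → x ∈ S → y ∈ S

  step : Subset n → Subset n
  step S y = S y ∨ does (FinP.any? (λ x → (S x Bool.≟ true) ×-dec A? x y))

  step-⊇ : ∀ S → S ⊆ step S
  step-⊇ S y y∈S rewrite y∈S = refl

  stable⇒closed : ∀ S → (∀ y → y ∈ step S → y ∈ S) → Closed S
  stable⇒closed S stable {x} {y} arc x∈S = stable y (trans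
    (cong (S y ∨_) (dec-true (FinP.any? (λ x → (S x Bool.≟ true) ×-dec A? x y)) (x , x∈S , arc)))
    (BoolP.∨-zeroʳ (S y)))

  private
    ∧-not-true : ∀ {a b} → a ∧ not b ≡ true → a ≡ true × b ≡ false
    ∧-not-true {true} {false} _ = refl , refl

  module _ (u : Fin n) where

    ReachableFrom : Subset n → Set
    ReachableFrom S = ∀ j → j ∈ S → Star A u j

    step-reachable : ∀ S → ReachableFrom S → ReachableFrom (step S)
    step-reachable S reach y y∈step with S y in y∈S
    ... | true = reach y y∈S
    ... | false with FinP.any? (λ x → (S x Bool.≟ true) ×-dec A? x y) | y∈step
    ...   | yes (x , x∈S , arc) | _ = reach x x∈S ◅◅ (arc ◅ ε)

    -- Each round either stabilises or strictly enlarges the set, so k > n - |S| rounds suffice.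
    iterate : ∀ k S → n < count n S ℕ.+ k → u ∈ S → ReachableFrom S →
              Σ (Subset n) λ S′ → u ∈ S′ × ReachableFrom S′ × Closed S′
    iterate zero S n<cS _ _ =
      ⊥-elim (ℕP.<⇒≱ n<cS (subst (_≤ n) (sym (ℕP.+-identityʳ _)) (count-≤ n S)))
    iterate (suc k) S n<cS+k u∈S reach with any-true? (λ y → step S y ∧ not (S y))
    ... | inj₂ none = S , u∈S , reach , stable⇒closed S stable
      where
      stable : ∀ y → y ∈ step S → y ∈ S
      stable y y∈step with S y | none y
      ... | true  | _       = refl
      ... | false | not-new with () ← trans (sym y∈step) (trans (sym (BoolP.∧-identityʳ _)) not-new)
    ... | inj₁ (y , new) with ∧-not-true {step S y} new
    ...   | y∈step , y∉S = iterate k (step S) n<cS′+k (step-⊇ S u u∈S) (step-reachable S reach)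
      where
      n<cS′+k : n < count n (step S) ℕ.+ k
      n<cS′+k = ℕP.≤-trans n<cS+k (ℕP.≤-trans (ℕP.≤-reflexive (ℕP.+-suc _ k))
                  (ℕP.+-monoˡ-≤ k (count-< n (step-⊇ S) y∈step y∉S)))

    reachableSet : Σ (Subset n) λ S → u ∈ S × ReachableFrom S × Closed S
    reachableSet = iterate n (_==F u)
      (subst (λ c → n < c ℕ.+ n) (sym (count-─ n {j = u} (==F-refl u))) (s≤s (ℕP.m≤n+m n _)))
      (==F-refl u) (λ j j≡u → subst (Star A u) (sym (==F⇒≡ j≡u)) ε)

-- d-directed orientations

module _ (G : PinnedGraph) (o : Orientation G) where

  endpoint⇒tail⊎head : ∀ e {j} → inner G e ≡ j ⊎ other G e ≡ inj₁ j →
                       tail G o e ≡ inj₁ j ⊎ head G o e ≡ inj₁ j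
  endpoint⇒tail⊎head e end with o e | end
  ... | true  | inj₁ refl = inj₁ refl
  ... | true  | inj₂ eq   = inj₂ eq
  ... | false | inj₁ refl = inj₂ refl
  ... | false | inj₂ eq   = inj₁ eq

  tail⊎head⇒endpoint : ∀ e {j} → tail G o e ≡ inj₁ j ⊎ head G o e ≡ inj₁ j →
                       inner G e ≡ j ⊎ other G e ≡ inj₁ j
  tail⊎head⇒endpoint e th with o e | th
  ... | true  | inj₁ eq = inj₁ (inj₁-injective eq)
  ... | true  | inj₂ eq = inj₂ eq
  ... | false | inj₁ eq = inj₂ eq
  ... | false | inj₂ eq = inj₁ (inj₁-injective eq)

module DDirectedOrientation {d : ℕ} {G : PinnedGraph} {o : Orientation G} (dd : DDirected d G o) where

  tail-inner : ∀ e → ∃[ j ] tail G o e ≡ inj₁ j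
  tail-inner e with tail G o e in eq
  ... | inj₁ j = j , refl
  ... | inj₂ k with () ←
    trans (sym (proj₂ dd k)) (count-─ (m G) {j = e} (trans (cong (_==V inj₂ k) eq) (==F-refl k)))

  tailVertex : Fin (m G) → Fin (nI G)
  tailVertex = proj₁ ∘ tail-inner

  tail≡ : ∀ e → tail G o e ≡ inj₁ (tailVertex e)
  tail≡ = proj₂ ∘ tail-inner

  count-tailIn : ∀ S → count (m G) (S ∘ tailVertex) ≡ d ℕ.* count (nI G) S
  count-tailIn S = count-preimage-≡ tailVertex d out-degree S
    where
    out-degree : ∀ u → fibre tailVertex d u ≡ d
    out-degree u = trans (count-cong (m G) (λ e → cong (_==V inj₁ u) (sym (tail≡ e)))) (proj₁ dd u)

  InnerArc : Fin (nI G) → Fin (nI G) → Set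
  InnerArc x y = ∃[ e ] (tailVertex e ≡ x × head G o e ≡ inj₁ y)

  innerArc? : ∀ x y → Dec (InnerArc x y)
  innerArc? x y =
    FinP.any? (λ e → (tailVertex e Fin.≟ x) ×-dec ≡-dec Fin._≟_ Fin._≟_ (head G o e) (inj₁ y))

  open Reachability InnerArc innerArc? using (Closed; reachableSet) public

  innerPath⇒reach : ∀ {x y} → Star InnerArc x y → Reach G o (inj₁ x) (inj₁ y)
  innerPath⇒reach = gmap inj₁ λ where
    (e , tail≡x , head≡y) → e , cong contract (trans (tail≡ e) (cong inj₁ tail≡x)) , cong contract head≡y

  closed-reach : ∀ {S u w} → Closed S → u ∈ S → Reach G o (inj₁ u) (inj₁ w) → w ∈ S
  closed-reach {S} cl u∈S path = star-preserves Inside step path (λ { _ refl → u∈S }) _ refl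
    where
    Inside : Fin (nI G) ⊎ ⊤ → Set
    Inside x = ∀ j → x ≡ inj₁ j → j ∈ S
    contract≡inj₁ : ∀ (v : Vtx (nI G) (nP G)) {j} → contract v ≡ inj₁ j → v ≡ inj₁ j
    contract≡inj₁ (inj₁ i) refl = refl
    step : ∀ {x y} → Arc G o x y → Inside x → Inside y
    step (e , tail↦x , head↦y) inside-x j refl =
      cl (e , refl , contract≡inj₁ (head G o e) head↦y)
         (inside-x _ (trans (sym tail↦x) (cong contract (tail≡ e))))

  closedSubgraph : (S : Subset (nI G)) → Closed S → Subgraph G
  closedSubgraph S cl = record
    { I' = S ; P' = λ _ → true ; E' = S ∘ tailVertex
    ; innerIn       = λ e tail∈S → endpoint∈ e tail∈S (inj₁ refl)
    ; otherInnerIn  = λ e j tail∈S other≡j → endpoint∈ e tail∈S (inj₂ other≡j)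
    ; otherPinnedIn = λ _ _ _ _ → refl }
    where
    endpoint∈ : ∀ e {j} → tailVertex e ∈ S → inner G e ≡ j ⊎ other G e ≡ inj₁ j → j ∈ S
    endpoint∈ e tail∈S end with endpoint⇒tail⊎head G o e end
    ... | inj₁ tail≡j = subst (_∈ S) (inj₁-injective (trans (sym (tail≡ e)) tail≡j)) tail∈S
    ... | inj₂ head≡j = cl {tailVertex e} (e , refl , head≡j) tail∈S

  closedSubgraph-tight : ∀ S (cl : Closed S) → Tight d G (closedSubgraph S cl)
  closedSubgraph-tight S _ = count-tailIn S

  -- The d |I' H| edges leaving I' H include E' H, so by counting they are exactly E' H.
  tight⇒closed : ∀ H → Tight d G H → Closed (I' H)
  tight⇒closed H tight (e , refl , head≡y) tail∈I =
    edge-endpoint∈ H (leaving⊆E e tail∈I) (tail⊎head⇒endpoint G o e (inj₂ head≡y))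
    where
    E⊆leaving : E' H ⊆ (I' H ∘ tailVertex)
    E⊆leaving e e∈E = edge-endpoint∈ H e∈E (tail⊎head⇒endpoint G o e (inj₁ (tail≡ e)))
    leaving⊆E : (I' H ∘ tailVertex) ⊆ E' H
    leaving⊆E = ⊆-count-≥⇒⊇ (m G) E⊆leaving (ℕP.≤-reflexive (trans (count-tailIn (I' H)) (sym tight)))

  properTight⇒decomposable : ∀ H → ProperSub G H → Tight d G H → ¬ Indecomposable G o
  properTight⇒decomposable H ((u , u∈I) , (w , w∉I)) tight indecomposable =
    ∈∉⇒⊥ {S = I' H} (closed-reach (tight⇒closed H tight) u∈I (indecomposable u w)) w∉I

  -- Otherwise the vertices reachable from u would span a proper tight, hence isostatic, subgraph.
  noProper⇒indecomposable : PinnedIsostatic d G → NoProperIsostaticSubgraph d G → Indecomposable G o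
  noProper⇒indecomposable iso noProper u w with reachableSet u
  ... | S , u∈S , reachable , closed with S w in w∈?S
  ...   | true  = innerPath⇒reach (reachable w w∈?S)
  ...   | false = ⊥-elim (noProper (closedSubgraph S closed , ((u , u∈S) , (w , w∈?S)) ,
                    tight⇒subgraphIsostatic {d} {G} iso (closedSubgraph S closed)
                                            (closedSubgraph-tight S closed)))

-- Orient each edge away from the vertex whose column a transversal of R(G,p₀) assigns to it.
isostatic⇒dDirected : ∀ {d G} → PinnedIsostatic d G → ∃[ o ] DDirected d G o
isostatic⇒dDirected {d} {G} (p₀ , sio) =
  o , out-degree , λ k → count-empty (m G) (λ e → cong (_==V inj₂ k) (tail≡ e))
  where
  M = rigidityMatrix d G p₀
  ns = squareInvertible⇒nonSingular {d} {G} {p₀} sio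
  m≡nd : m G ≡ nI G ℕ.* d
  m≡nd = trans (sym (count-full (m G))) (trans (proj₁ ns) (count-full (nI G ℕ.* d)))
  transversal = nonSingular⇒transversal {M = M} (Fin.cast m≡nd) (m G) (count-full (m G)) ns
  f = proj₁ transversal
  vertex : Fin (m G) → Fin (nI G)
  vertex e = Fin.quotient {nI G} d (f e)
  o : Orientation G
  o e = inner G e ==F vertex e
  tail≡ : ∀ e → tail G o e ≡ inj₁ (vertex e)
  tail≡ e with inner G e Fin.≟ vertex e
  ... | yes inner≡v = cong inj₁ inner≡v
  ... | no inner≢v with rigidity≢0⇒endpoint {d} {G} {p₀} (proj₂ (proj₁ (proj₂ transversal) e refl))
  ...   | inj₁ inner≡v = ⊥-elim (inner≢v inner≡v)
  ...   | inj₂ other≡v = other≡v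
  fibre≤d : ∀ u → fibre vertex d u ≤ d
  fibre≤d u = count-injective-≤ (m G) _ (Fin.remainder {nI G} d ∘ f) λ {x} {y} x↦u y↦u rx≡ry →
    proj₂ (proj₂ transversal) refl refl (remQuot-injective {nI G} d
      (cong₂ _,_ (trans (==F⇒≡ x↦u) (sym (==F⇒≡ y↦u))) rx≡ry))
  out-degree : ∀ u → count (m G) (λ e → tail G o e ==V inj₁ u) ≡ d
  out-degree u = trans (count-cong (m G) (λ e → cong (_==V inj₁ u) (tail≡ e)))
                       (fibres-full vertex d fibre≤d m≡nd u)

-- Genericity

cast-injective : ∀ {a b} (eq : a ≡ b) → Injective _≡_ _≡_ (Fin.cast eq)
cast-injective eq {x} {y} cx≡cy =
  FinP.toℕ-injective (trans (sym (FinP.toℕ-cast eq x)) (trans (cong toℕ cx≡cy) (FinP.toℕ-cast eq y)))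

sumFin-cast : ∀ {a b} (eq : a ≡ b) (g : Fin b → ℚ) → sumFin a (g ∘ Fin.cast eq) ≡ sumFin b g
sumFin-cast {a} refl g = sumFin-cong a (λ x → cong g (FinP.cast-is-id refl x))

module _ {d : ℕ} {G : PinnedGraph} {p : Config d G} where

  private
    M = rigidityMatrix d G p
    N = nI G ℕ.* d

  nonSingular⇒rankAtLeast : ∀ {R C} → NonSingular M R C → RankAtLeast d G p (count (m G) R)
  nonSingular⇒rankAtLeast {R} {C} ns@(cR≡cC , _) =
    row , remQuot {nI G} d ∘ col , enum-injective (m G) R ,
    col-injective ∘ remQuot-injective {nI G} d , B , RB≡I , BR≡I
    where
    K = count (m G) R
    B′ = proj₁ (nonSingular⇒inverse ns)
    row : Fin K → Fin (m G)
    row = enum (m G) R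
    col : Fin K → Fin N
    col = enum N C ∘ Fin.cast cR≡cC
    col-injective : Injective _≡_ _≡_ col
    col-injective = cast-injective cR≡cC ∘ enum-injective N C
    B : Fin K → Fin K → ℚ
    B x t = B′ (col x) (row t)
    RB≡I : ∀ s t → sumFin K (λ x → M (row s) (col x) * B x t) ≡ δ (s ==F t)
    RB≡I s t = begin
      sumFin K (λ x → M (row s) (col x) * B′ (col x) (row t))
        ≡⟨ sumFin-cast cR≡cC (λ y → M (row s) (enum N C y) * B′ (enum N C y) (row t)) ⟩
      sumFin (count N C) (λ y → M (row s) (enum N C y) * B′ (enum N C y) (row t))
        ≡⟨ sumOn-enum N C (λ y → M (row s) y * B′ y (row t)) ⟨
      sumOn N C (λ y → M (row s) y * B′ y (row t))
        ≡⟨ proj₁ (proj₂ (nonSingular⇒inverse ns)) (row s) (row t) (enum-∈ (m G) R s) (enum-∈ (m G) R t) ⟩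
      δ (row s ==F row t)
        ≡⟨ cong δ (==F-injective (enum-injective (m G) R) s t) ⟩
      δ (s ==F t) ∎
      where open ≡-Reasoning
    BR≡I : ∀ s t → sumFin K (λ x → B s x * M (row x) (col t)) ≡ δ (s ==F t)
    BR≡I s t = begin
      sumFin K (λ x → B′ (col s) (row x) * M (row x) (col t))
        ≡⟨ sumOn-enum (m G) R (λ e → B′ (col s) e * M e (col t)) ⟨
      sumOn (m G) R (λ e → B′ (col s) e * M e (col t))
        ≡⟨ proj₂ (proj₂ (nonSingular⇒inverse ns)) (col s) (col t)
             (enum-∈ N C (Fin.cast cR≡cC s)) (enum-∈ N C (Fin.cast cR≡cC t)) ⟩
      δ (col s ==F col t)
        ≡⟨ cong δ (==F-injective col-injective s t) ⟩
      δ (s ==F t) ∎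
      where open ≡-Reasoning

  -- R(G,p) has nonsingular minors of every size up to |E|, and no configuration has larger rank.
  squareInvertible⇒generic : SquareInvertibleOn d G p (λ _ → true) (λ _ → true) → Generic d G p
  squareInvertible⇒generic sio q k (row , _ , row-injective , _) with
    nonSingular⇒minor {M = M} (m G ℕ.∸ k) k
      (trans (count-full (m G)) (sym (ℕP.m∸n+n≡m (FinP.injective⇒≤ row-injective))))
      (squareInvertible⇒nonSingular {d} {G} {p} sio)
  ... | R′ , C′ , cR′≡k , ns′ = subst (RankAtLeast d G p) cR′≡k (nonSingular⇒rankAtLeast ns′)

injective⇒surjective : ∀ {n} (f : Fin n → Fin n) → Injective _≡_ _≡_ f → ∀ y → ∃[ x ] f x ≡ y
injective⇒surjective {suc n} f f-injective y with FinP.any? (λ x → f x Fin.≟ y)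
... | yes found = found
... | no missed = ⊥-elim (ℕP.1+n≰n (FinP.injective⇒≤ {f = f′} f′-injective))
  where
  y≢f : ∀ x → y ≢ f x
  y≢f x y≡fx = missed (x , sym y≡fx)
  f′ : Fin (suc n) → Fin n
  f′ x = Fin.punchOut (y≢f x)
  f′-injective : Injective _≡_ _≡_ f′
  f′-injective {x} {x′} eq = f-injective (FinP.punchOut-injective (y≢f x) (y≢f x′) eq)

rightInverse⇒row≢0 : ∀ {k} (A B : Matrix k k) → (∀ s t → sumFin k (λ x → A s x * B x t) ≡ δ (s ==F t)) →
                     ∀ s → ∃[ x ] A s x ≢ 0ℚ
rightInverse⇒row≢0 {k} A B AB≡I s with FinP.any? (λ x → ¬? (A s x ℚP.≟ 0ℚ))
... | yes found = found
... | no none = ⊥-elim (0≢1 (begin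
  0ℚ                                 ≡⟨ sumFin-zero k ⟨
  sumFin k (λ _ → 0ℚ)
    ≡⟨ sumFin-cong k (λ x → trans (sym (ℚP.*-zeroˡ (B x s))) (cong (_* B x s) (sym (row≡0 x)))) ⟩
  sumFin k (λ x → A s x * B x s)     ≡⟨ AB≡I s s ⟩
  δ (s ==F s)                        ≡⟨ cong δ (==F-refl s) ⟩
  1ℚ                                 ∎))
  where
  open ≡-Reasoning
  0≢1 : 0ℚ ≢ 1ℚ
  0≢1 ()
  row≡0 : ∀ x → A s x ≡ 0ℚ
  row≡0 x = decidable-stable (A s x ℚP.≟ 0ℚ) (λ ≢0 → none (x , ≢0))

-- Lower block-triangular decompositions

module _ {d : ℕ} {G : PinnedGraph} where

  -- Blocks: (E' H , I' H) first, then the complementary rows and vertices.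
  properTight⇒properLBT : PinnedIsostatic d G → ∀ H → ProperSub G H → Tight d G H → ∀ p → HasProperLBT d G p
  properTight⇒properLBT (_ , sio) H ((u , u∈I) , (w , w∉I)) tight p = D , s≤s (s≤s z≤n)
    where
    block : Bool → Fin 2
    block b = if b then zero else suc zero
    block≡0 : ∀ b → (block b ==F zero) ≡ b
    block≡0 true  = refl
    block≡0 false = refl
    block≡1 : ∀ b → (block b ==F suc zero) ≡ not b
    block≡1 true  = refl
    block≡1 false = refl
    cE = count (m G) (E' H)
    cI = count (nI G) (I' H)
    cI∁ = count (nI G) (not ∘ I' H)
    complement-tight : count (m G) (not ∘ E' H) ≡ d ℕ.* cI∁
    complement-tight = ℕP.+-cancelˡ-≡ cE _ _ (begin
      cE ℕ.+ count (m G) (not ∘ E' H)    ≡⟨ count-compl (m G) (E' H) ⟩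
      m G                                ≡⟨ count-full (m G) ⟨
      count (m G) (λ _ → true)           ≡⟨ proj₁ sio ⟩
      d ℕ.* count (nI G) (λ _ → true)
        ≡⟨ cong (d ℕ.*_) (trans (count-full (nI G)) (sym (count-compl (nI G) (I' H)))) ⟩
      d ℕ.* (cI ℕ.+ cI∁)                 ≡⟨ ℕP.*-distribˡ-+ d cI cI∁ ⟩
      d ℕ.* cI ℕ.+ d ℕ.* cI∁             ≡⟨ cong (ℕ._+ d ℕ.* cI∁) tight ⟨
      cE ℕ.+ d ℕ.* cI∁                   ∎)
      where open ≡-Reasoning
    square₂ : ∀ b → count (m G) (λ e → block (E' H e) ==F b) ≡ d ℕ.* count (nI G) (λ i → block (I' H i) ==F b)
    square₂ zero = trans (count-cong (m G) (block≡0 ∘ E' H))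
                        (trans tight (cong (d ℕ.*_) (count-cong (nI G) (sym ∘ block≡0 ∘ I' H))))
    square₂ (suc zero) = trans (count-cong (m G) (block≡1 ∘ E' H))
                              (trans complement-tight (cong (d ℕ.*_) (count-cong (nI G) (sym ∘ block≡1 ∘ I' H))))
    nonempty₂ : ∀ b → ∃[ i ] block (I' H i) ≡ b
    nonempty₂ zero       = u , cong block u∈I
    nonempty₂ (suc zero) = w , cong block w∉I
    lower₂ : ∀ e i a → rigidity d G p e (i , a) ≢ 0ℚ → toℕ (block (I' H i)) ≤ toℕ (block (E' H e))
    lower₂ e i a nz with E' H e in e∈?E
    ... | true rewrite edge-endpoint∈ H e∈?E (rigidity≢0⇒endpoint {d} {G} {p} nz) = z≤n
    ... | false with I' H i
    ...   | true  = z≤n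
    ...   | false = s≤s z≤n
    D : LowerBlockTriangular d G p
    D = record { blocks = 2 ; rowBlock = block ∘ E' H ; vtxBlock = block ∘ I' H
               ; square = square₂ ; nonempty = nonempty₂ ; lower = lower₂ }

  generic⇒endpointEntries≢0 : PinnedIsostatic d G → ∀ {p} → Generic d G p → ∀ e →
    ∃[ a ] ∀ {j} → inner G e ≡ j ⊎ other G e ≡ inj₁ j → rigidity d G p e (j , a) ≢ 0ℚ
  generic⇒endpointEntries≢0 (p₀ , sio) {p} generic e =
    let row , col , row-injective , _ , B , RB≡I , _ = generic p₀ (m G) full-rank
        s , row-s≡e = injective⇒surjective row row-injective e
        x , nz = rightInverse⇒row≢0 (λ s x → rigidity d G p (row s) (col x)) B RB≡I s
    in proj₂ (col x) , rigidity-endpoints≢0 {d} {G} {p}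
                         (subst (λ e′ → rigidity d G p e′ (col x) ≢ 0ℚ) row-s≡e nz)
    where
    full-rank : RankAtLeast d G p₀ (m G)
    full-rank = subst (RankAtLeast d G p₀) (count-full (m G))
                  (nonSingular⇒rankAtLeast {d} {G} {p₀} (squareInvertible⇒nonSingular {d} {G} {p₀} sio))

  -- The first diagonal block spans a proper tight subgraph: generically every edge row has
  -- nonzero entries at all its inner endpoints, which lower-triangularity keeps in that block.
  noProper⇒noProperLBT : PinnedIsostatic d G → NoProperIsostaticSubgraph d G →
                         ∀ p → Generic d G p → ¬ HasProperLBT d G p
  noProper⇒noProperLBT iso noProper p generic (D , 2≤blocks) =
    noProper (H , proper , tight⇒subgraphIsostatic iso H (square D b₀))
    where
    b₀ b₁ : Fin (blocks D)
    b₀ = Fin.fromℕ< (ℕP.≤-trans (s≤s z≤n) 2≤blocks)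
    b₁ = Fin.fromℕ< 2≤blocks
    InB₀ : ∀ {n} → (Fin n → Fin (blocks D)) → Subset n
    InB₀ block x = block x ==F b₀
    below-b₀ : ∀ x → toℕ x ≤ toℕ b₀ → (x ==F b₀) ≡ true
    below-b₀ x x≤b₀ = subst (λ y → (x ==F y) ≡ true)
      (FinP.toℕ-injective (trans (ℕP.n≤0⇒n≡0 (subst (toℕ x ≤_) (FinP.toℕ-fromℕ< _) x≤b₀))
                                 (sym (FinP.toℕ-fromℕ< _))))
      (==F-refl x)
    endpoint∈B₀ : ∀ {e j} → e ∈ InB₀ (rowBlock D) → inner G e ≡ j ⊎ other G e ≡ inj₁ j → j ∈ InB₀ (vtxBlock D)
    endpoint∈B₀ {e} {j} e∈B₀ end =
      let a , nz = generic⇒endpointEntries≢0 iso {p} generic e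
      in below-b₀ (vtxBlock D j) (ℕP.≤-trans (lower D e j a (nz end)) (ℕP.≤-reflexive (cong toℕ (==F⇒≡ e∈B₀))))
    H : Subgraph G
    H = record
      { I' = InB₀ (vtxBlock D) ; P' = λ _ → true ; E' = InB₀ (rowBlock D)
      ; innerIn       = λ e e∈B₀ → endpoint∈B₀ e∈B₀ (inj₁ refl)
      ; otherInnerIn  = λ e j e∈B₀ eq → endpoint∈B₀ e∈B₀ (inj₂ eq)
      ; otherPinnedIn = λ _ _ _ _ → refl }
    b₁≢b₀ : b₁ ≢ b₀
    b₁≢b₀ b₁≡b₀ = 1≢0 (begin
      1           ≡⟨ FinP.toℕ-fromℕ< 2≤blocks ⟨
      toℕ b₁      ≡⟨ cong toℕ b₁≡b₀ ⟩
      toℕ b₀      ≡⟨ FinP.toℕ-fromℕ< _ ⟩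
      0           ∎)
      where
      open ≡-Reasoning
      1≢0 : 1 ≢ 0
      1≢0 ()
    proper : ProperSub G H
    proper =
      let i , i↦b₀ = nonempty D b₀
          j , j↦b₁ = nonempty D b₁
      in (i , trans (cong (_==F b₀) i↦b₀) (==F-refl b₀)) ,
         (j , ==F-false (λ j↦b₀ → b₁≢b₀ (trans (sym j↦b₁) j↦b₀)))

theorem3p4 : (d : ℕ) → 1 ≤ d → (G : PinnedGraph) → PinnedIsostatic d G →
      (NoProperIsostaticSubgraph d G ⇔
         (∃[ o ] (DDirected d G o × Indecomposable G o)))
    × (NoProperIsostaticSubgraph d G ⇔
         (∀ o → DDirected d G o → Indecomposable G o))
    × (NoProperIsostaticSubgraph d G ⇔
         (∃[ p ] (Generic d G p × ¬ HasProperLBT d G p)))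
    × (NoProperIsostaticSubgraph d G ⇔
         (∀ p → Generic d G p → ¬ HasProperLBT d G p))
theorem3p4 d _ G iso@(p₀ , sio) =
  mk⇔ (λ noProper → o₀ , dd₀ , noProper⇒indecomposable dd₀ iso noProper)
      (λ { (o , dd , indecomposable) → noProperTight (λ H proper tight →
             properTight⇒decomposable dd H proper tight indecomposable) }) ,
  mk⇔ (λ noProper o dd → noProper⇒indecomposable dd iso noProper)
      (λ indecomposable → noProperTight (λ H proper tight →
             properTight⇒decomposable dd₀ H proper tight (indecomposable o₀ dd₀))) ,
  mk⇔ (λ noProper → p₀ , generic₀ , noProper⇒noProperLBT iso noProper p₀ generic₀)
      (λ { (p , _ , ¬lbt) → noProperTight (λ H proper tight →
             ¬lbt (properTight⇒properLBT iso H proper tight p)) }) ,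
  mk⇔ (noProper⇒noProperLBT iso)
      (λ ¬lbt → noProperTight (λ H proper tight →
             ¬lbt p₀ generic₀ (properTight⇒properLBT iso H proper tight p₀)))
  where
  open DDirectedOrientation using (noProper⇒indecomposable; properTight⇒decomposable)
  o₀ = proj₁ (isostatic⇒dDirected {d} {G} iso)
  dd₀ = proj₂ (isostatic⇒dDirected {d} {G} iso)
  generic₀ = squareInvertible⇒generic {d} {G} {p₀} sio
  noProperTight : (∀ H → ProperSub G H → Tight d G H → ⊥) → NoProperIsostaticSubgraph d G
  noProperTight noTight (H , proper , H-iso) = noTight H proper (subgraphIsostatic⇒tight H H-iso)
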